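{- Let $p$ be an odd prime and let $f_{m,n}(z)=\sum_{j=0}^{n}\binom{n}{j}z^{\binom{j}{m}}$. Let $n=j(p-1)p$, or, when $p\equiv\pm1\pmod 8$, also $n=j(p-1)p/2$, where $j\geq 1$ is an integer with $p\nmid j$. Then $f_{n-1,n}(z)$ and $f_{n-2,n}(z)$ are irreducible over $\mathbb{Q}$.
   Context: Here $\binom{j}{m}=0$ for $0\le j<m$. -}

module Defs where

open import Data.Nat as ℕ using (ℕ; zero; suc)
open import Data.Nat.Combinatorics using (_C_)
open import Data.Integer as ℤ using (ℤ)
open import Data.Rational as ℚ using (ℚ; 0ℚ)
open import Data.List using (List; []; _∷_; replicate; _++_; foldr; map; upTo)
open import Data.Sum using (_⊎_)
open import Data.Product using (_×_)
open import Relation.Binary.PropositionalEquality using (_≡_)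
open import Relation.Nullary using (¬_)

-- Polynomials over ℚ as coefficient lists (lowest degree first);
-- positions beyond the end of the list are zero coefficients.
Poly : Set
Poly = List ℚ

coeff : Poly → ℕ → ℚ
coeff []       _       = 0ℚ
coeff (a ∷ _)  zero    = a
coeff (_ ∷ as) (suc i) = coeff as i

_≈ₚ_ : Poly → Poly → Set
f ≈ₚ g = ∀ i → coeff f i ≡ coeff g i

_+ₚ_ : Poly → Poly → Poly
[]       +ₚ g        = g
f        +ₚ []       = f
(a ∷ as) +ₚ (b ∷ bs) = (a ℚ.+ b) ∷ (as +ₚ bs)

scale : ℚ → Poly → Poly
scale c = map (c ℚ.*_)

_*ₚ_ : Poly → Poly → Poly
[]       *ₚ g = []
(a ∷ as) *ₚ g = scale a g +ₚ (0ℚ ∷ (as *ₚ g))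

monomial : ℚ → ℕ → Poly
monomial c k = replicate k 0ℚ ++ (c ∷ [])

IsConstant : Poly → Set
IsConstant f = ∀ i → coeff f (suc i) ≡ 0ℚ

-- irreducible over ℚ: non-constant (degree ≥ 1), and any factorization
-- f = g h in ℚ[z] has a constant (necessarily nonzero, i.e. unit) factor
Irreducible : Poly → Set
Irreducible f = ¬ IsConstant f × (∀ g h → f ≈ₚ (g *ₚ h) → IsConstant g ⊎ IsConstant h)

ℕtoℚ : ℕ → ℚ
ℕtoℚ k = ℤ.+ k ℚ./ 1

f : ℕ → ℕ → Poly
f m n = foldr (λ j acc → monomial (ℕtoℚ (n C j)) (j C m) +ₚ acc) [] (upTo (suc n))

-- Since C(j, m) = 0 for j < m, the terms with j < m add up to a constant c, and
--   f_{n-1,n}(z) = z^n + n z + c                          with c = 2^n − n − 1,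
--   f_{n-2,n}(z) = z^{C(n,2)} + n z^{n-1} + C(n,2) z + c  with c = 2^n − C(n,2) − n − 1.
-- The hypotheses give n = X p with p ∤ X, where X is a multiple of p − 1, or of (p − 1)/2 when
-- p ≡ ±1 (mod 8). Gauss's lemma gives 2^((p−1)/2) ≡ ±1 (mod p), with + when p ≡ ±1 (mod 8), so
-- 2^X ≡ 1 (mod p); and x ≡ 1 (mod p) implies x^p ≡ 1 (mod p²), so 2^n ≡ 1 (mod p²). Hence c ≡ −n,
-- resp. c ≡ −n(n+1)/2 (mod p²), and as p is odd and exactly divides n, both polynomials are
-- Eisenstein at p. Eisenstein's criterion over ℚ is proved with the p-adic valuation v: if F = g h
-- and a, b are the first indices where v is minimal on the coefficients of g and h, then the
-- coefficient of F at a + b has valuation exactly v(g_a) + v(h_b).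

module Submission where

open import Defs
open import Data.Nat as ℕ
  using (ℕ; zero; suc; _+_; _*_; _∸_; _^_; _/_; _%_; _!; _⊓_; _<_; _≤_; _≥_; z≤n; s≤s; NonZero)
import Data.Nat.Properties as ℕ
open import Data.Nat.Divisibility as ℕ using (_∣_; divides)
open import Data.Nat.DivMod using (m≡m%n+[m/n]*n; m*n/n≡m)
open import Data.Nat.Induction using (<-wellFounded)
open import Data.Nat.Primality using (Prime; euclidsLemma; prime⇒nonZero; prime⇒nonTrivial)
open import Data.Nat.Combinatorics
  using (_C_; nCn≡1; nC1≡n; nCk≡nC[n∸k]; k>n⇒nCk≡0; nCk+nC[k+1]≡[n+1]C[k+1])
open import Data.Nat.Coprimality as Coprimality using (1-coprimeTo)
open import Data.Nat.Tactic.RingSolver using (solve-∀)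
open import Data.Integer as ℤ using (ℤ; +_; -[1+_]; +0; +[1+_]; _⊖_; ∣_∣; 0ℤ; 1ℤ; -1ℤ)
import Data.Integer.Properties as ℤ
import Data.Integer.Divisibility.Signed as ℤ
import Data.Integer.GCD as ℤ
import Data.Integer.Tactic.RingSolver as ℤ-Solver
open import Data.Rational as ℚ using (ℚ; mkℚ; 0ℚ; 1ℚ; ↥_; ↧_; ↧ₙ_)
import Data.Rational.Properties as ℚ
open import Data.List using ([]; _∷_; _∷ʳ_; foldr; upTo)
import Data.List.Properties as List
open import Data.Product using (∃; _×_; _,_; proj₁; proj₂)
open import Data.Sum using (_⊎_; inj₁; inj₂)
open import Data.Empty using (⊥)
open import Function using (_∘_)
open import Induction.WellFounded using (Acc; acc)
open import Algebra.Properties.Group ℚ.+-0-group using (inverseˡ-unique)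
open import Relation.Binary.Definitions using (tri<; tri≈; tri>)
open import Relation.Binary.PropositionalEquality
open import Relation.Nullary using (¬_; yes; no; contradiction)

module ℕValuation {p : ℕ} (p-prime : Prime p) where

  open import Data.Nat
  open import Data.Nat.Properties
  open import Data.Nat.Divisibility

  instance
    p≢0 : NonZero p
    p≢0 = prime⇒nonZero p-prime

    p-nonTrivial : NonTrivial p
    p-nonTrivial = prime⇒nonTrivial p-prime

  p∤1 : ¬ p ∣ 1
  p∤1 p∣1 = <⇒≢ (nonTrivial⇒n>1 p) (sym (∣1⇒≡1 p∣1))

  p∤u*w : ∀ {u w} → ¬ p ∣ u → ¬ p ∣ w → ¬ p ∣ u * w
  p∤u*w {u} {w} p∤u p∤w p∣uw with euclidsLemma u w p-prime p∣uw
  ... | inj₁ p∣u = p∤u p∣u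
  ... | inj₂ p∣w = p∤w p∣w

  p^m∣p^n : ∀ {m n} → m ≤ n → p ^ m ∣ p ^ n
  p^m∣p^n {m} {n} m≤n = divides (p ^ (n ∸ m))
    (trans (cong (p ^_) (sym (m∸n+n≡m m≤n))) (^-distribˡ-+-* p (n ∸ m) m))

  record PowerSplit (m : ℕ) : Set where
    field
      exponent cofactor : ℕ
      split             : m ≡ p ^ exponent * cofactor
      p∤cofactor        : ¬ p ∣ cofactor

  powerSplit : ∀ m → .{{NonZero m}} → PowerSplit m
  powerSplit m = go m (<-wellFounded m)
    where
    go : ∀ m → .{{NonZero m}} → Acc _<_ m → PowerSplit m
    go m (acc rec) with p ∣? m
    ... | no p∤m = record
      { exponent = 0 ; cofactor = m ; split = sym (+-identityʳ m) ; p∤cofactor = p∤m }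
    ... | yes p∣m = record
      { exponent = suc e ; cofactor = u ; split = m≡p^[1+e]*u ; p∤cofactor = p∤u }
      where
      q = quotient p∣m
      instance _ = quotient≢0 p∣m
      open PowerSplit (go q (rec (quotient-< p∣m)))
        renaming (exponent to e; cofactor to u; split to q≡p^e*u; p∤cofactor to p∤u)
      m≡p^[1+e]*u : m ≡ p * p ^ e * u
      m≡p^[1+e]*u = begin
        m               ≡⟨ m∣n⇒n≡quotient*m p∣m ⟩
        q * p           ≡⟨ cong (_* p) q≡p^e*u ⟩
        p ^ e * u * p   ≡⟨ *-comm (p ^ e * u) p ⟩
        p * (p ^ e * u) ≡⟨ *-assoc p (p ^ e) u ⟨
        p * p ^ e * u   ∎
        where open ≡-Reasoning

  -- Opaque, so that ν of a successor is not unfolded by the unifier.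
  opaque
    ν : ℕ → ℕ
    ν zero        = 0
    ν m@(suc _) = PowerSplit.exponent (powerSplit m)

    ν-split : ∀ m → .{{NonZero m}} → ∃ λ u → m ≡ p ^ ν m * u × ¬ p ∣ u
    ν-split m@(suc _) = cofactor , split , p∤cofactor
      where open PowerSplit (powerSplit m)

  exponent-unique : ∀ a b {u w} → p ^ a * u ≡ p ^ b * w → ¬ p ∣ u → ¬ p ∣ w → a ≡ b
  exponent-unique zero    zero    eq p∤u p∤w = refl
  exponent-unique zero    (suc b) eq p∤u p∤w = contradiction
    (subst (p ∣_) (trans (sym eq) (*-identityˡ _)) (∣m⇒∣m*n _ (m∣m*n (p ^ b)))) p∤u
  exponent-unique (suc a) zero    eq p∤u p∤w = sym (exponent-unique zero (suc a) (sym eq) p∤w p∤u)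
  exponent-unique (suc a) (suc b) {u} {w} eq p∤u p∤w = cong suc (exponent-unique a b
    (*-cancelˡ-≡ _ _ p (trans (sym (*-assoc p (p ^ a) u)) (trans eq (*-assoc p (p ^ b) w))))
    p∤u p∤w)

  ν-unique : ∀ {m} e {u} → m ≡ p ^ e * u → ¬ p ∣ u → ν m ≡ e
  ν-unique {zero} e {u} eq p∤u = contradiction (subst (p ∣_) (sym u≡0) (p ∣0)) p∤u
    where
    u≡0 : u ≡ 0
    u≡0 = m*n≡0⇒m≡0 u (p ^ e) {{m^n≢0 p e}} (trans (*-comm u (p ^ e)) (sym eq))
  ν-unique {m@(suc _)} e eq p∤u with ν-split m
  ... | u′ , m≡p^νm*u′ , p∤u′ = exponent-unique _ e (trans (sym m≡p^νm*u′) eq) p∤u′ p∤u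

  ν-1 : ν 1 ≡ 0
  ν-1 = ν-unique 0 refl p∤1

  ν-* : ∀ m n → .{{NonZero m}} → .{{NonZero n}} → ν (m * n) ≡ ν m + ν n
  ν-* m n with ν-split m | ν-split n
  ... | u , m≡ , p∤u | w , n≡ , p∤w = ν-unique (ν m + ν n) m*n≡ (p∤u*w p∤u p∤w)
    where
    m*n≡ : m * n ≡ p ^ (ν m + ν n) * (u * w)
    m*n≡ = begin
      m * n                       ≡⟨ cong₂ _*_ m≡ n≡ ⟩
      p ^ ν m * u * (p ^ ν n * w) ≡⟨ interchange (p ^ ν m) u (p ^ ν n) w ⟩
      p ^ ν m * p ^ ν n * (u * w) ≡⟨ cong (_* (u * w)) (^-distribˡ-+-* p (ν m) (ν n)) ⟨
      p ^ (ν m + ν n) * (u * w)   ∎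
      where
      open ≡-Reasoning
      interchange : ∀ a b c d → a * b * (c * d) ≡ a * c * (b * d)
      interchange = solve-∀

  ^∣⇒≤ν : ∀ e m → .{{NonZero m}} → p ^ e ∣ m → e ≤ ν m
  ^∣⇒≤ν e m p^e∣m with e ≤? ν m | ν-split m
  ... | yes e≤νm | _ = e≤νm
  ... | no e≰νm | u , m≡ , p∤u = contradiction p∣u p∤u
    where
    p^νm*p∣p^νm*u : p ^ ν m * p ∣ p ^ ν m * u
    p^νm*p∣p^νm*u = subst₂ _∣_ (*-comm p (p ^ ν m)) m≡ (∣-trans (p^m∣p^n (≰⇒> e≰νm)) p^e∣m)
    p∣u : p ∣ u
    p∣u = *-cancelˡ-∣ (p ^ ν m) {{m^n≢0 p (ν m)}} p^νm*p∣p^νm*u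

  ≤ν⇒^∣ : ∀ e m → e ≤ ν m → p ^ e ∣ m
  ≤ν⇒^∣ e zero      e≤νm = (p ^ e) ∣0
  ≤ν⇒^∣ e m@(suc _) e≤νm with ν-split m
  ... | u , m≡ , _ = subst (p ^ e ∣_) (sym m≡) (∣m⇒∣m*n u (p^m∣p^n e≤νm))

+-cancelʳ-⊖ : ∀ m n o → (m + o) ⊖ (n + o) ≡ m ⊖ n
+-cancelʳ-⊖ m n o = trans (cong₂ _⊖_ (ℕ.+-comm m o) (ℕ.+-comm n o)) (ℤ.+-cancelˡ-⊖ o m n)

⊖-cross : ∀ a b c d → a + d ≡ c + b → a ⊖ b ≡ c ⊖ d
⊖-cross a b c d a+d≡c+b = begin
  a ⊖ b             ≡⟨ +-cancelʳ-⊖ a b d ⟨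
  (a + d) ⊖ (b + d) ≡⟨ cong₂ _⊖_ a+d≡c+b (ℕ.+-comm b d) ⟩
  (c + b) ⊖ (d + b) ≡⟨ +-cancelʳ-⊖ c d b ⟩
  c ⊖ d             ∎
  where open ≡-Reasoning

+-⊖-distrib : ∀ a b c d → (a + b) ⊖ (c + d) ≡ (a ⊖ c) ℤ.+ (b ⊖ d)
+-⊖-distrib a b c d = begin
  (a + b) ⊖ (c + d)                 ≡⟨ ℤ.[+m]-[+n]≡m⊖n (a + b) (c + d) ⟨
  + (a + b) ℤ.- + (c + d)           ≡⟨ cong₂ ℤ._-_ (ℤ.pos-+ a b) (ℤ.pos-+ c d) ⟩
  (+ a ℤ.+ + b) ℤ.- (+ c ℤ.+ + d)   ≡⟨ regroup (+ a) (+ b) (+ c) (+ d) ⟩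
  (+ a ℤ.- + c) ℤ.+ (+ b ℤ.- + d)   ≡⟨ cong₂ ℤ._+_ (ℤ.[+m]-[+n]≡m⊖n a c) (ℤ.[+m]-[+n]≡m⊖n b d) ⟩
  (a ⊖ c) ℤ.+ (b ⊖ d)               ∎
  where
  open ≡-Reasoning
  regroup : ∀ a b c d → (a ℤ.+ b) ℤ.- (c ℤ.+ d) ≡ (a ℤ.- c) ℤ.+ (b ℤ.- d)
  regroup = ℤ-Solver.solve-∀

≤-⊖-⊓ : ∀ {c} m n o → c ℤ.≤ m ⊖ o → c ℤ.≤ n ⊖ o → c ℤ.≤ (m ⊓ n) ⊖ o
≤-⊖-⊓ m n o c≤m⊖o c≤n⊖o with ℕ.⊓-sel m n
... | inj₁ m⊓n≡m = subst (λ k → _ ℤ.≤ k ⊖ o) (sym m⊓n≡m) c≤m⊖o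
... | inj₂ m⊓n≡n = subst (λ k → _ ℤ.≤ k ⊖ o) (sym m⊓n≡n) c≤n⊖o

x+y-y≡x : ∀ x y → x ℚ.+ y ℚ.- y ≡ x
x+y-y≡x x y = begin
  x ℚ.+ y ℚ.- y   ≡⟨ ℚ.+-assoc x y (ℚ.- y) ⟩
  x ℚ.+ (y ℚ.- y) ≡⟨ cong (x ℚ.+_) (ℚ.+-inverseʳ y) ⟩
  x ℚ.+ 0ℚ        ≡⟨ ℚ.+-identityʳ x ⟩
  x               ∎
  where open ≡-Reasoning

↥[i/n]*n≡i*↧[i/n] : ∀ i n .{{_ : NonZero n}} → ↥ (i ℚ./ n) ℤ.* + n ≡ i ℤ.* ↧ (i ℚ./ n)
↥[i/n]*n≡i*↧[i/n] i n = begin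
  ↥ q ℤ.* + n         ≡⟨ cong (↥ q ℤ.*_) (ℚ.↧-/ i n) ⟨
  ↥ q ℤ.* (↧ q ℤ.* g) ≡⟨ swap (↥ q) (↧ q) g ⟩
  ↥ q ℤ.* g ℤ.* ↧ q   ≡⟨ cong (ℤ._* ↧ q) (ℚ.↥-/ i n) ⟩
  i ℤ.* ↧ q           ∎
  where
  open ≡-Reasoning
  q = i ℚ./ n
  g = ℤ.gcd i (+ n)
  swap : ∀ a b c → a ℤ.* (b ℤ.* c) ≡ a ℤ.* c ℤ.* b
  swap = ℤ-Solver.solve-∀

∣∣-nonZero : ∀ {a} → a ≢ 0ℤ → NonZero ∣ a ∣
∣∣-nonZero a≢0 = ℕ.≢-nonZero (a≢0 ∘ ℤ.∣i∣≡0⇒i≡0)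

fraction≢0 : ∀ x {a d} → a ≢ 0ℤ → ↥ x ℤ.* + d ≡ a ℤ.* ↧ x → x ≢ 0ℚ
fraction≢0 x@(mkℚ _ _ _) {a} {d} a≢0 eq x≡0
  with ℤ.i*j≡0⇒i≡0∨j≡0 a (trans (sym eq) (cong (ℤ._* + d) (ℚ.p≡0⇒↥p≡0 x x≡0)))
... | inj₁ a≡0 = a≢0 a≡0

↥≢0 : ∀ x → x ≢ 0ℚ → ↥ x ≢ 0ℤ
↥≢0 x x≢0 = x≢0 ∘ ℚ.↥p≡0⇒p≡0 x

↥*↥≢0 : ∀ {x y} → x ≢ 0ℚ → y ≢ 0ℚ → ↥ x ℤ.* ↥ y ≢ 0ℤ
↥*↥≢0 {x} {y} x≢0 y≢0 xy≡0 with ℤ.i*j≡0⇒i≡0∨j≡0 (↥ x) xy≡0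
... | inj₁ ↥x≡0 = ↥≢0 x x≢0 ↥x≡0
... | inj₂ ↥y≡0 = ↥≢0 y y≢0 ↥y≡0

*-≢0 : ∀ {x y} → x ≢ 0ℚ → y ≢ 0ℚ → x ℚ.* y ≢ 0ℚ
*-≢0 {x@(mkℚ a _ _)} {y@(mkℚ b _ _)} x≢0 y≢0 =
  fraction≢0 (x ℚ.* y) (↥*↥≢0 x≢0 y≢0) (↥[i/n]*n≡i*↧[i/n] (a ℤ.* b) (↧ₙ x * ↧ₙ y))

+m≢0 : ∀ m .{{_ : NonZero m}} → + m ≢ 0ℤ
+m≢0 m = ℕ.≢-nonZero⁻¹ m ∘ ℤ.+-injective

ℕtoℚ≢0 : ∀ m .{{_ : NonZero m}} → ℕtoℚ m ≢ 0ℚ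
ℕtoℚ≢0 m = fraction≢0 (ℕtoℚ m) (+m≢0 m) (↥[i/n]*n≡i*↧[i/n] (+ m) 1)

module ℚValuation {p : ℕ} (p-prime : Prime p) where

  open ℕValuation p-prime

  ν∣∣-+ : ∀ s t → s ℤ.+ t ≢ 0ℤ → ν ∣ s ∣ ⊓ ν ∣ t ∣ ≤ ν ∣ s ℤ.+ t ∣
  ν∣∣-+ s t s+t≢0 = ^∣⇒≤ν e ∣ s ℤ.+ t ∣ {{∣∣-nonZero s+t≢0}}
    (ℤ.∣⇒∣ᵤ (ℤ.∣m∣n⇒∣m+n (p^e∣ s (ℕ.m⊓n≤m _ _)) (p^e∣ t (ℕ.m⊓n≤n _ _))))
    where
    e = ν ∣ s ∣ ⊓ ν ∣ t ∣
    p^e∣ : ∀ r → e ≤ ν ∣ r ∣ → + (p ^ e) ℤ.∣ r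
    p^e∣ r e≤νr = ℤ.∣ᵤ⇒∣ (≤ν⇒^∣ e ∣ r ∣ e≤νr)

  v : ℚ → ℤ
  v x = ν ∣ ↥ x ∣ ⊖ ν (↧ₙ x)

  v-fraction : ∀ x {a d} .{{_ : NonZero d}} → a ≢ 0ℤ → ↥ x ℤ.* + d ≡ a ℤ.* ↧ x →
               v x ≡ ν ∣ a ∣ ⊖ ν d
  v-fraction x@(mkℚ _ _ _) {a} {d} a≢0 eq = ⊖-cross (ν ∣ ↥ x ∣) (ν (↧ₙ x)) (ν ∣ a ∣) (ν d) (begin
    ν ∣ ↥ x ∣ ℕ.+ ν d      ≡⟨ ν-* ∣ ↥ x ∣ d {{∣∣-nonZero (↥≢0 x (fraction≢0 x a≢0 eq))}} ⟨
    ν (∣ ↥ x ∣ ℕ.* d)      ≡⟨ cong ν (ℤ.abs-* (↥ x) (+ d)) ⟨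
    ν ∣ ↥ x ℤ.* + d ∣    ≡⟨ cong (ν ∘ ∣_∣) eq ⟩
    ν ∣ a ℤ.* ↧ x ∣      ≡⟨ cong ν (ℤ.abs-* a (↧ x)) ⟩
    ν (∣ a ∣ ℕ.* ↧ₙ x)     ≡⟨ ν-* ∣ a ∣ (↧ₙ x) {{∣∣-nonZero a≢0}} ⟩
    ν ∣ a ∣ ℕ.+ ν (↧ₙ x)   ∎)
    where open ≡-Reasoning

  ν∣i*↧∣ : ∀ i z → i ≢ 0ℤ → ν ∣ i ℤ.* ↧ z ∣ ≡ ν ∣ i ∣ ℕ.+ ν (↧ₙ z)
  ν∣i*↧∣ i z@(mkℚ _ _ _) i≢0 =
    trans (cong ν (ℤ.abs-* i (↧ z))) (ν-* ∣ i ∣ (↧ₙ z) {{∣∣-nonZero i≢0}})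

  v-* : ∀ {x y} → x ≢ 0ℚ → y ≢ 0ℚ → v (x ℚ.* y) ≡ v x ℤ.+ v y
  v-* {x@(mkℚ a _ _)} {y@(mkℚ b _ _)} x≢0 y≢0 = begin
    v (x ℚ.* y)
      ≡⟨ v-fraction (x ℚ.* y) (↥*↥≢0 x≢0 y≢0) (↥[i/n]*n≡i*↧[i/n] (a ℤ.* b) (↧ₙ x * ↧ₙ y)) ⟩
    ν ∣ a ℤ.* b ∣ ⊖ ν (↧ₙ x * ↧ₙ y)
      ≡⟨ cong₂ _⊖_ ν∣ab∣ (ν-* (↧ₙ x) (↧ₙ y)) ⟩
    (ν ∣ a ∣ ℕ.+ ν ∣ b ∣) ⊖ (ν (↧ₙ x) + ν (↧ₙ y))
      ≡⟨ +-⊖-distrib (ν ∣ a ∣) (ν ∣ b ∣) (ν (↧ₙ x)) (ν (↧ₙ y)) ⟩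
    v x ℤ.+ v y ∎
    where
    open ≡-Reasoning
    ν∣ab∣ : ν ∣ a ℤ.* b ∣ ≡ ν ∣ a ∣ ℕ.+ ν ∣ b ∣
    ν∣ab∣ = trans (cong ν (ℤ.abs-* a b))
      (ν-* ∣ a ∣ ∣ b ∣ {{∣∣-nonZero (↥≢0 x x≢0)}} {{∣∣-nonZero (↥≢0 y y≢0)}})

  v-+ : ∀ {c x y} → x ≢ 0ℚ → y ≢ 0ℚ → x ℚ.+ y ≢ 0ℚ →
        c ℤ.≤ v x → c ℤ.≤ v y → c ℤ.≤ v (x ℚ.+ y)
  v-+ {c} {x@(mkℚ a _ _)} {y@(mkℚ b _ _)} x≢0 y≢0 x+y≢0 c≤vx c≤vy = begin
    c                        ≤⟨ ≤-⊖-⊓ (ν ∣ s ∣) (ν ∣ t ∣) D (subst (c ℤ.≤_) vx≡ c≤vx)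
                                                          (subst (c ℤ.≤_) vy≡ c≤vy) ⟩
    (ν ∣ s ∣ ⊓ ν ∣ t ∣) ⊖ D  ≤⟨ ℤ.⊖-monoˡ-≤ D (ν∣∣-+ s t s+t≢0) ⟩
    ν ∣ s ℤ.+ t ∣ ⊖ D        ≡⟨ cong (ν ∣ s ℤ.+ t ∣ ⊖_) (ν-* (↧ₙ x) (↧ₙ y)) ⟨
    ν ∣ s ℤ.+ t ∣ ⊖ ν (↧ₙ x * ↧ₙ y)
      ≡⟨ v-fraction (x ℚ.+ y) s+t≢0 (↥[i/n]*n≡i*↧[i/n] (s ℤ.+ t) (↧ₙ x * ↧ₙ y)) ⟨
    v (x ℚ.+ y)              ∎
    where
    open ℤ.≤-Reasoning
    s = a ℤ.* ↧ y
    t = b ℤ.* ↧ x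
    D = ν (↧ₙ x) + ν (↧ₙ y)
    s+t≢0 : s ℤ.+ t ≢ 0ℤ
    s+t≢0 s+t≡0 = x+y≢0 (trans (cong (ℚ._/ (↧ₙ x * ↧ₙ y)) s+t≡0) (ℚ.0/n≡0 (↧ₙ x * ↧ₙ y)))
    vx≡ : v x ≡ ν ∣ s ∣ ⊖ D
    vx≡ = trans (sym (+-cancelʳ-⊖ (ν ∣ a ∣) (ν (↧ₙ x)) (ν (↧ₙ y))))
                (cong (_⊖ D) (sym (ν∣i*↧∣ a y (↥≢0 x x≢0))))
    vy≡ : v y ≡ ν ∣ t ∣ ⊖ D
    vy≡ = trans (sym (+-cancelʳ-⊖ (ν ∣ b ∣) (ν (↧ₙ y)) (ν (↧ₙ x))))
                (cong₂ _⊖_ (sym (ν∣i*↧∣ b x (↥≢0 y y≢0))) (ℕ.+-comm (ν (↧ₙ y)) (ν (↧ₙ x))))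

  v-neg : ∀ x → v (ℚ.- x) ≡ v x
  v-neg (mkℚ -[1+ _ ] _ _) = refl
  v-neg (mkℚ +0       _ _) = refl
  v-neg (mkℚ +[1+ _ ] _ _) = refl

  v-1 : v 1ℚ ≡ 0ℤ
  v-1 = ℤ.n⊖n≡0 (ν 1)

  v-ℕtoℚ : ∀ m .{{_ : NonZero m}} → v (ℕtoℚ m) ≡ + ν m
  v-ℕtoℚ m = begin
    v (ℕtoℚ m) ≡⟨ v-fraction (ℕtoℚ m) (+m≢0 m) (↥[i/n]*n≡i*↧[i/n] (+ m) 1) ⟩
    ν m ⊖ ν 1  ≡⟨ cong (ν m ⊖_) ν-1 ⟩
    ν m ⊖ 0    ≡⟨ ℤ.≤-⊖ z≤n ⟩
    + ν m      ∎
    where open ≡-Reasoning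

  infix 4 _≤ᵥ_ _≡ᵥ_

  -- c ≤ᵥ x reads c ≤ v x with the convention v 0 = +∞.
  _≤ᵥ_ : ℤ → ℚ → Set
  c ≤ᵥ x = x ≢ 0ℚ → c ℤ.≤ v x

  _≡ᵥ_ : ℤ → ℚ → Set
  c ≡ᵥ x = x ≢ 0ℚ × v x ≡ c

  ≡0⇒≤ᵥ : ∀ {c x} → x ≡ 0ℚ → c ≤ᵥ x
  ≡0⇒≤ᵥ x≡0 x≢0 = contradiction x≡0 x≢0

  ≡ᵥ⇒≤ᵥ : ∀ {c x} → c ≡ᵥ x → c ≤ᵥ x
  ≡ᵥ⇒≤ᵥ (_ , vx≡c) _ = ℤ.≤-reflexive (sym vx≡c)

  ≡ᵥ∧≤ᵥ⇒≤ : ∀ {c d x} → c ≡ᵥ x → d ≤ᵥ x → d ℤ.≤ c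
  ≡ᵥ∧≤ᵥ⇒≤ (x≢0 , vx≡c) d≤ᵥx = subst (_ ℤ.≤_) vx≡c (d≤ᵥx x≢0)

  ≤ᵥ-weaken : ∀ {c d x} → c ℤ.≤ d → d ≤ᵥ x → c ≤ᵥ x
  ≤ᵥ-weaken c≤d d≤ᵥx x≢0 = ℤ.≤-trans c≤d (d≤ᵥx x≢0)

  ≤ᵥ-* : ∀ {c d x y} → c ≤ᵥ x → d ≤ᵥ y → c ℤ.+ d ≤ᵥ x ℚ.* y
  ≤ᵥ-* {c} {d} {x} {y} c≤ᵥx d≤ᵥy xy≢0 =
    subst (c ℤ.+ d ℤ.≤_) (sym (v-* x≢0 y≢0)) (ℤ.+-mono-≤ (c≤ᵥx x≢0) (d≤ᵥy y≢0))
    where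
    x≢0 : x ≢ 0ℚ
    x≢0 x≡0 = xy≢0 (trans (cong (ℚ._* y) x≡0) (ℚ.*-zeroˡ y))
    y≢0 : y ≢ 0ℚ
    y≢0 y≡0 = xy≢0 (trans (cong (x ℚ.*_) y≡0) (ℚ.*-zeroʳ x))

  ≡ᵥ-* : ∀ {c d x y} → c ≡ᵥ x → d ≡ᵥ y → c ℤ.+ d ≡ᵥ x ℚ.* y
  ≡ᵥ-* (x≢0 , vx≡c) (y≢0 , vy≡d) =
    *-≢0 x≢0 y≢0 , trans (v-* x≢0 y≢0) (cong₂ ℤ._+_ vx≡c vy≡d)

  ≤ᵥ-+ : ∀ {c x y} → c ≤ᵥ x → c ≤ᵥ y → c ≤ᵥ x ℚ.+ y
  ≤ᵥ-+ {c} {x} {y} c≤ᵥx c≤ᵥy x+y≢0 with x ℚ.≟ 0ℚ | y ℚ.≟ 0ℚ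
  ... | yes x≡0 | _ = subst (λ z → c ℤ.≤ v z) (sym 0+y≡y) (c≤ᵥy (x+y≢0 ∘ trans 0+y≡y))
    where 0+y≡y = trans (cong (ℚ._+ y) x≡0) (ℚ.+-identityˡ y)
  ... | no _ | yes y≡0 = subst (λ z → c ℤ.≤ v z) (sym x+0≡x) (c≤ᵥx (x+y≢0 ∘ trans x+0≡x))
    where x+0≡x = trans (cong (x ℚ.+_) y≡0) (ℚ.+-identityʳ x)
  ... | no x≢0 | no y≢0 = v-+ x≢0 y≢0 x+y≢0 (c≤ᵥx x≢0) (c≤ᵥy y≢0)

  ≤ᵥ-neg : ∀ {c x} → c ≤ᵥ x → c ≤ᵥ ℚ.- x
  ≤ᵥ-neg {c} {x} c≤ᵥx -x≢0 = subst (c ℤ.≤_) (sym (v-neg x)) (c≤ᵥx (-x≢0 ∘ cong (ℚ.-_)))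

  ≡ᵥ-+ : ∀ {c x y} → c ≡ᵥ x → ℤ.suc c ≤ᵥ y → c ≡ᵥ x ℚ.+ y
  ≡ᵥ-+ {c} {x} {y} (x≢0 , vx≡c) 1+c≤ᵥy = x+y≢0 , ℤ.≤-antisym v[x+y]≤c c≤v[x+y]
    where
    1+c≰vx : ¬ ℤ.suc c ℤ.≤ v x
    1+c≰vx 1+c≤vx = ℤ.<-irrefl (sym vx≡c) (ℤ.suc[i]≤j⇒i<j 1+c≤vx)

    x+y≢0 : x ℚ.+ y ≢ 0ℚ
    x+y≢0 x+y≡0 =
      1+c≰vx (subst (ℤ.suc c ℤ.≤_) (trans (sym (v-neg y)) (cong v (sym x≡-y))) (1+c≤ᵥy y≢0))
      where
      x≡-y = inverseˡ-unique x y x+y≡0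
      y≢0 : y ≢ 0ℚ
      y≢0 y≡0 = x≢0 (trans x≡-y (cong (ℚ.-_) y≡0))

    c≤v[x+y] : c ℤ.≤ v (x ℚ.+ y)
    c≤v[x+y] = ≤ᵥ-+ (≡ᵥ⇒≤ᵥ (x≢0 , vx≡c)) (≤ᵥ-weaken (ℤ.i≤suc[i] c) 1+c≤ᵥy) x+y≢0

    v[x+y]≤c : v (x ℚ.+ y) ℤ.≤ c
    v[x+y]≤c = ℤ.≮⇒≥ λ c<v[x+y] → 1+c≰vx (subst (λ z → ℤ.suc c ℤ.≤ v z) (x+y-y≡x x y)
      (≤ᵥ-+ {x = x ℚ.+ y} (λ _ → ℤ.i<j⇒suc[i]≤j c<v[x+y]) (≤ᵥ-neg 1+c≤ᵥy)
            (x≢0 ∘ trans (sym (x+y-y≡x x y)))))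

  ≡ᵥ-+ʳ : ∀ {c x y} → ℤ.suc c ≤ᵥ x → c ≡ᵥ y → c ≡ᵥ x ℚ.+ y
  ≡ᵥ-+ʳ {c} {x} {y} 1+c≤ᵥx c≡ᵥy = subst (c ≡ᵥ_) (ℚ.+-comm y x) (≡ᵥ-+ c≡ᵥy 1+c≤ᵥx)

  ≤ᵥ-1 : ∀ {c} → c ≤ᵥ 1ℚ → c ℤ.≤ 0ℤ
  ≤ᵥ-1 {c} c≤ᵥ1 = subst (c ℤ.≤_) v-1 (c≤ᵥ1 λ ())

  ∣⇒1≤ᵥ : ∀ {m} → p ∣ m → 1ℤ ≤ᵥ ℕtoℚ m
  ∣⇒1≤ᵥ {zero}      _   = ≡0⇒≤ᵥ refl
  ∣⇒1≤ᵥ {m@(suc _)} p∣m _ = subst (1ℤ ℤ.≤_) (sym (v-ℕtoℚ m))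
    (ℤ.+≤+ (^∣⇒≤ν 1 m (subst (_∣ m) (sym (ℕ.*-identityʳ p)) p∣m)))

  ∣∧∤⇒1≡ᵥ : ∀ {m} → p ∣ m → ¬ p * p ∣ m → 1ℤ ≡ᵥ ℕtoℚ m
  ∣∧∤⇒1≡ᵥ {zero}      _   p²∤m = contradiction ((p * p) ℕ.∣0) p²∤m
  ∣∧∤⇒1≡ᵥ {m@(suc _)} p∣m p²∤m = ℕtoℚ≢0 m , trans (v-ℕtoℚ m) (cong +_ νm≡1)
    where
    νm≡1 : ν m ≡ 1
    νm≡1 = ℕ.≤-antisym
      (ℕ.≮⇒≥ λ 1<νm → p²∤m (subst (_∣ m) (cong (p *_) (ℕ.*-identityʳ p)) (≤ν⇒^∣ 2 m 1<νm)))
      (^∣⇒≤ν 1 m (subst (_∣ m) (sym (ℕ.*-identityʳ p)) p∣m))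

coeff-+ₚ : ∀ g h i → coeff (g +ₚ h) i ≡ coeff g i ℚ.+ coeff h i
coeff-+ₚ []       h        i       = sym (ℚ.+-identityˡ (coeff h i))
coeff-+ₚ (a ∷ as) []       i       = sym (ℚ.+-identityʳ (coeff (a ∷ as) i))
coeff-+ₚ (a ∷ as) (b ∷ bs) zero    = refl
coeff-+ₚ (a ∷ as) (b ∷ bs) (suc i) = coeff-+ₚ as bs i

coeff-scale : ∀ c g i → coeff (scale c g) i ≡ c ℚ.* coeff g i
coeff-scale c []       i       = sym (ℚ.*-zeroʳ c)
coeff-scale c (a ∷ as) zero    = refl
coeff-scale c (a ∷ as) (suc i) = coeff-scale c as i

convolution : (ℕ → ℚ) → (ℕ → ℚ) → ℕ → ℚ
convolution G H zero    = G 0 ℚ.* H 0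
convolution G H (suc k) = G 0 ℚ.* H (suc k) ℚ.+ convolution (G ∘ suc) H k

convolution-zeroˡ : ∀ H k → convolution (λ _ → 0ℚ) H k ≡ 0ℚ
convolution-zeroˡ H zero    = ℚ.*-zeroˡ (H 0)
convolution-zeroˡ H (suc k) = cong₂ ℚ._+_ (ℚ.*-zeroˡ (H (suc k))) (convolution-zeroˡ H k)

coeff-*ₚ : ∀ g h k → coeff (g *ₚ h) k ≡ convolution (coeff g) (coeff h) k
coeff-*ₚ []       h k       = sym (convolution-zeroˡ (coeff h) k)
coeff-*ₚ (a ∷ as) h zero    = begin
  coeff (scale a h +ₚ (0ℚ ∷ (as *ₚ h))) 0 ≡⟨ coeff-+ₚ (scale a h) _ 0 ⟩
  coeff (scale a h) 0 ℚ.+ 0ℚ             ≡⟨ ℚ.+-identityʳ _ ⟩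
  coeff (scale a h) 0                    ≡⟨ coeff-scale a h 0 ⟩
  a ℚ.* coeff h 0                        ∎
  where open ≡-Reasoning
coeff-*ₚ (a ∷ as) h (suc k) =
  trans (coeff-+ₚ (scale a h) (0ℚ ∷ (as *ₚ h)) (suc k))
        (cong₂ ℚ._+_ (coeff-scale a h (suc k)) (coeff-*ₚ as h k))

module _ (P : ℚ → Set) (P-+ : ∀ {x y} → P x → P y → P (x ℚ.+ y)) where

  convolution-closed : ∀ G H k → (∀ i j → i + j ≡ k → P (G i ℚ.* H j)) →
                       P (convolution G H k)
  convolution-closed G H zero    P-terms = P-terms 0 0 refl
  convolution-closed G H (suc k) P-terms = P-+ (P-terms 0 (suc k) refl)
    (convolution-closed (G ∘ suc) H k (λ i j i+j≡k → P-terms (suc i) j (cong suc i+j≡k)))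

  module _ (Q : ℚ → Set) (Q-+P : ∀ {x y} → Q x → P y → Q (x ℚ.+ y))
                         (P-+Q : ∀ {x y} → P x → Q y → Q (x ℚ.+ y)) where

    convolution-dominant : ∀ G H a b → Q (G a ℚ.* H b) →
                           (∀ i j → i + j ≡ a + b → i ≢ a → P (G i ℚ.* H j)) →
                           Q (convolution G H (a + b))
    convolution-dominant G H zero    zero    Q-term P-others = Q-term
    convolution-dominant G H zero    (suc b) Q-term P-others = Q-+P Q-term
      (convolution-closed (G ∘ suc) H b
        (λ i j i+j≡b → P-others (suc i) j (cong suc i+j≡b) λ ()))
    convolution-dominant G H (suc a) b       Q-term P-others =
      P-+Q (P-others 0 (suc (a + b)) refl λ ()) (convolution-dominant (G ∘ suc) H a b Q-term
        (λ i j i+j≡a+b i≢a → P-others (suc i) j (cong suc i+j≡a+b) (i≢a ∘ ℕ.suc-injective)))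

record Degree (g : Poly) (D : ℕ) : Set where
  field
    leading≢0      : coeff g D ≢ 0ℚ
    vanishes-above : ∀ i → D < i → coeff g i ≡ 0ℚ

zero-or-degree : ∀ g → (∀ i → coeff g i ≡ 0ℚ) ⊎ ∃ (Degree g)
zero-or-degree []       = inj₁ λ _ → refl
zero-or-degree (a ∷ as) with zero-or-degree as
... | inj₂ (D , record { leading≢0 = ≢0 ; vanishes-above = above }) = inj₂ (suc D , record
  { leading≢0 = ≢0 ; vanishes-above = λ { (suc i) (s≤s D<i) → above i D<i } })
... | inj₁ as≡0 with a ℚ.≟ 0ℚ
...   | yes a≡0 = inj₁ λ { zero → a≡0 ; (suc i) → as≡0 i }
...   | no a≢0  = inj₂ (0 , record
  { leading≢0 = a≢0 ; vanishes-above = λ { (suc i) _ → as≡0 i } })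

constant-or-degree : ∀ g → IsConstant g ⊎ ∃ λ D → Degree g (suc D)
constant-or-degree g with zero-or-degree g
... | inj₁ g≡0           = inj₁ (g≡0 ∘ suc)
... | inj₂ (zero , deg)  = inj₁ λ i → Degree.vanishes-above deg (suc i) (s≤s z≤n)
... | inj₂ (suc D , deg) = inj₂ (D , deg)

≤-degree : ∀ {g D i} → Degree g D → coeff g i ≢ 0ℚ → i ≤ D
≤-degree {i = i} deg gᵢ≢0 = ℕ.≮⇒≥ (gᵢ≢0 ∘ Degree.vanishes-above deg i)

leading-*ₚ : ∀ {g h D E} → Degree g D → Degree h E → coeff (g *ₚ h) (D + E) ≢ 0ℚ
leading-*ₚ {g} {h} {D} {E} deg-g deg-h = subst (_≢ 0ℚ) (sym (coeff-*ₚ g h (D + E)))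
  (convolution-dominant (_≡ 0ℚ) 0+0≡0 (_≢ 0ℚ) ≢0+0≢0 0+≢0≢0 (coeff g) (coeff h) D E
    (*-≢0 (leading≢0 deg-g) (leading≢0 deg-h)) other-terms)
  where
  open Degree
  0+0≡0 : ∀ {x y} → x ≡ 0ℚ → y ≡ 0ℚ → x ℚ.+ y ≡ 0ℚ
  0+0≡0 refl refl = refl
  ≢0+0≢0 : ∀ {x y} → x ≢ 0ℚ → y ≡ 0ℚ → x ℚ.+ y ≢ 0ℚ
  ≢0+0≢0 {x} x≢0 refl = subst (_≢ 0ℚ) (sym (ℚ.+-identityʳ x)) x≢0
  0+≢0≢0 : ∀ {x y} → x ≡ 0ℚ → y ≢ 0ℚ → x ℚ.+ y ≢ 0ℚ
  0+≢0≢0 {y = y} refl y≢0 = subst (_≢ 0ℚ) (sym (ℚ.+-identityˡ y)) y≢0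
  other-terms : ∀ i j → i + j ≡ D + E → i ≢ D → coeff g i ℚ.* coeff h j ≡ 0ℚ
  other-terms i j i+j≡D+E i≢D with ℕ.<-cmp i D
  ... | tri< i<D _ _ =
    trans (cong (coeff g i ℚ.*_) (vanishes-above deg-h j E<j)) (ℚ.*-zeroʳ (coeff g i))
    where
    E<j : E < j
    E<j = ℕ.+-cancelˡ-< i E j (subst (i + E <_) (sym i+j≡D+E) (ℕ.+-monoˡ-< E i<D))
  ... | tri≈ _ i≡D _ = contradiction i≡D i≢D
  ... | tri> _ _ D<i =
    trans (cong (ℚ._* coeff h j) (vanishes-above deg-g i D<i)) (ℚ.*-zeroˡ (coeff h j))

degree-*ₚ-≤ : ∀ {F g h D E N} → F ≈ₚ (g *ₚ h) → Degree g D → Degree h E →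
              (∀ i → N < i → coeff F i ≡ 0ℚ) → D + E ≤ N
degree-*ₚ-≤ {D = D} {E} F≈gh deg-g deg-h F-above = ℕ.≮⇒≥ λ N<D+E →
  leading-*ₚ deg-g deg-h (trans (sym (F≈gh (D + E))) (F-above (D + E) N<D+E))

module Eisenstein {p : ℕ} (p-prime : Prime p) where

  open ℚValuation p-prime

  record MinValuation (g : Poly) : Set where
    field
      index         : ℕ
      value         : ℤ
      attained      : value ≡ᵥ coeff g index
      bounded       : ∀ i → value ≤ᵥ coeff g i
      strict-before : ∀ i → i < index → ℤ.suc value ≤ᵥ coeff g i

  zero-or-minValuation : ∀ g → (∀ i → coeff g i ≡ 0ℚ) ⊎ MinValuation g
  zero-or-minValuation []       = inj₁ λ _ → refl
  zero-or-minValuation (x ∷ xs) with zero-or-minValuation xs | x ℚ.≟ 0ℚ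
  ... | inj₁ xs≡0 | yes x≡0 = inj₁ λ { zero → x≡0 ; (suc i) → xs≡0 i }
  ... | inj₁ xs≡0 | no x≢0  = inj₂ record
    { index = 0 ; value = v x ; attained = x≢0 , refl ; strict-before = λ _ ()
    ; bounded = λ { zero _ → ℤ.≤-refl ; (suc i) → ≡0⇒≤ᵥ (xs≡0 i) } }
  ... | inj₂ m | yes x≡0 = inj₂ record
    { index = suc index ; value = value ; attained = attained
    ; bounded = λ { zero → ≡0⇒≤ᵥ x≡0 ; (suc i) → bounded i }
    ; strict-before = λ { zero _ → ≡0⇒≤ᵥ x≡0
                        ; (suc i) (s≤s i<index) → strict-before i i<index } }
    where open MinValuation m
  ... | inj₂ m | no x≢0 with value ℤ.<? v x
    where open MinValuation m
  ...   | yes value<vx = inj₂ record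
    { index = suc index ; value = value ; attained = attained
    ; bounded = λ { zero _ → ℤ.<⇒≤ value<vx ; (suc i) → bounded i }
    ; strict-before = λ { zero _ _ → ℤ.i<j⇒suc[i]≤j value<vx
                        ; (suc i) (s≤s i<index) → strict-before i i<index } }
    where open MinValuation m
  ...   | no value≮vx = inj₂ record
    { index = 0 ; value = v x ; attained = x≢0 , refl ; strict-before = λ _ ()
    ; bounded = λ { zero _ → ℤ.≤-refl ; (suc i) → ≤ᵥ-weaken (ℤ.≮⇒≥ value≮vx) (bounded i) } }
    where open MinValuation m

  minValuation : ∀ {g D} → Degree g D → MinValuation g
  minValuation {g} {D} deg with zero-or-minValuation g
  ... | inj₁ g≡0 = contradiction (g≡0 D) (Degree.leading≢0 deg)
  ... | inj₂ m   = m

  module _ {F g h} (F≈gh : F ≈ₚ (g *ₚ h)) (mg : MinValuation g) (mh : MinValuation h) where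

    open MinValuation mg using () renaming (index to a; value to α; attained to α-attained;
                                            bounded to α-bounded; strict-before to α-strict)
    open MinValuation mh using () renaming (index to b; value to β; attained to β-attained;
                                            bounded to β-bounded; strict-before to β-strict)

    product-attained : α ℤ.+ β ≡ᵥ coeff F (a + b)
    product-attained = subst (α ℤ.+ β ≡ᵥ_) (sym (trans (F≈gh (a + b)) (coeff-*ₚ g h (a + b))))
      (convolution-dominant (ℤ.suc (α ℤ.+ β) ≤ᵥ_) ≤ᵥ-+ (α ℤ.+ β ≡ᵥ_) ≡ᵥ-+ ≡ᵥ-+ʳ
        (coeff g) (coeff h) a b (≡ᵥ-* α-attained β-attained) other-terms)
      where
      other-terms : ∀ i j → i + j ≡ a + b → i ≢ a →
                    ℤ.suc (α ℤ.+ β) ≤ᵥ coeff g i ℚ.* coeff h j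
      other-terms i j i+j≡a+b i≢a with ℕ.<-cmp i a
      ... | tri< i<a _ _ =
        subst (_≤ᵥ _) (ℤ.+-assoc 1ℤ α β) (≤ᵥ-* (α-strict i i<a) (β-bounded j))
      ... | tri≈ _ i≡a _ = contradiction i≡a i≢a
      ... | tri> _ _ a<i =
        subst (_≤ᵥ _) (suc-shift α β) (≤ᵥ-* (α-bounded i) (β-strict j j<b))
        where
        j<b : j < b
        j<b = ℕ.+-cancelˡ-< a j b (subst (a + j <_) i+j≡a+b (ℕ.+-monoˡ-< j a<i))
        suc-shift : ∀ α β → α ℤ.+ (1ℤ ℤ.+ β) ≡ 1ℤ ℤ.+ (α ℤ.+ β)
        suc-shift = ℤ-Solver.solve-∀

    product-bounded : ∀ k → α ℤ.+ β ≤ᵥ coeff F k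
    product-bounded k = subst (α ℤ.+ β ≤ᵥ_) (sym (trans (F≈gh k) (coeff-*ₚ g h k)))
      (convolution-closed (α ℤ.+ β ≤ᵥ_) ≤ᵥ-+ (coeff g) (coeff h) k
        (λ i j _ → ≤ᵥ-* (α-bounded i) (β-bounded j)))

  module _ {F N} (monic : coeff F N ≡ 1ℚ) (F-above : ∀ i → N < i → coeff F i ≡ 0ℚ)
           (p∣lower : ∀ i → i < N → 1ℤ ≤ᵥ coeff F i) (p²∤constant : 1ℤ ≡ᵥ coeff F 0) where

    -- Monicity forces α + β ≤ 0, so the dominant coefficient at a + b cannot lie below N; hence
    -- a + b = N and α + β = 0. If a and b were both positive, the constant coefficient g₀ h₀
    -- would have valuation at least 2; so one factor carries all of the degree N.
    module Factorisation {g h} (F≈gh : F ≈ₚ (g *ₚ h))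
                         (mg : MinValuation g) (mh : MinValuation h) where

      open MinValuation mg using ()
        renaming (index to a; value to α; attained to α-attained; strict-before to α-strict)
      open MinValuation mh using ()
        renaming (index to b; value to β; attained to β-attained; strict-before to β-strict)

      attained : α ℤ.+ β ≡ᵥ coeff F (a + b)
      attained = product-attained {F} F≈gh mg mh

      α+β≤0 : α ℤ.+ β ℤ.≤ 0ℤ
      α+β≤0 = ≤ᵥ-1 (subst (α ℤ.+ β ≤ᵥ_) monic (product-bounded {F} F≈gh mg mh N))

      a+b≡N : a + b ≡ N
      a+b≡N with ℕ.<-cmp (a + b) N
      ... | tri< a+b<N _ _ = contradiction
        (ℤ.≤-trans (≡ᵥ∧≤ᵥ⇒≤ attained (p∣lower (a + b) a+b<N)) α+β≤0) λ { (ℤ.+≤+ ()) }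
      ... | tri≈ _ a+b≡N _ = a+b≡N
      ... | tri> _ _ N<a+b = contradiction (F-above (a + b) N<a+b) (proj₁ attained)

      α+β≡0 : α ℤ.+ β ≡ 0ℤ
      α+β≡0 = trans (sym (proj₂ attained))
                    (trans (cong (v ∘ coeff F) a+b≡N) (trans (cong v monic) v-1))

      a≡0⊎b≡0 : a ≡ 0 ⊎ b ≡ 0
      a≡0⊎b≡0 with a ℕ.≟ 0 | b ℕ.≟ 0
      ... | yes a≡0 | _       = inj₁ a≡0
      ... | no _    | yes b≡0 = inj₂ b≡0
      ... | no a≢0  | no b≢0  = contradiction
        (ℤ.≤-trans 2≤1+α+1+β (≡ᵥ∧≤ᵥ⇒≤ p²∤constant 2≤ᵥF₀)) λ { (ℤ.+≤+ (s≤s ())) }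
        where
        2≤ᵥF₀ : ℤ.suc α ℤ.+ ℤ.suc β ≤ᵥ coeff F 0
        2≤ᵥF₀ = subst (_ ≤ᵥ_) (sym (trans (F≈gh 0) (coeff-*ₚ g h 0)))
          (≤ᵥ-* (α-strict 0 (ℕ.n≢0⇒n>0 a≢0)) (β-strict 0 (ℕ.n≢0⇒n>0 b≢0)))
        2≤1+α+1+β : + 2 ℤ.≤ ℤ.suc α ℤ.+ ℤ.suc β
        2≤1+α+1+β = ℤ.≤-reflexive (sym (trans (regroup α β) (cong (ℤ._+_ (+ 2)) α+β≡0)))
          where
          regroup : ∀ α β → (1ℤ ℤ.+ α) ℤ.+ (1ℤ ℤ.+ β) ≡ + 2 ℤ.+ (α ℤ.+ β)
          regroup = ℤ-Solver.solve-∀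

      N≤D⊎N≤E : ∀ {D E} → Degree g D → Degree h E → N ≤ D ⊎ N ≤ E
      N≤D⊎N≤E deg-g deg-h with a≡0⊎b≡0
      ... | inj₁ a≡0 = inj₂ (≤-degree deg-h (subst (λ k → coeff h k ≢ 0ℚ) b≡N (proj₁ β-attained)))
        where
        b≡N : b ≡ N
        b≡N = subst (λ a → a + b ≡ N) a≡0 a+b≡N
      ... | inj₂ b≡0 = inj₁ (≤-degree deg-g (subst (λ k → coeff g k ≢ 0ℚ) a≡N (proj₁ α-attained)))
        where
        a≡N : a ≡ N
        a≡N = trans (sym (ℕ.+-identityʳ a)) (subst (λ b → a + b ≡ N) b≡0 a+b≡N)

    eisenstein : Irreducible F
    eisenstein = nonconstant , factor-constant
      where
      nonconstant : ¬ IsConstant F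
      nonconstant F-constant = top-coefficient N monic
        where
        top-coefficient : ∀ n → coeff F n ≡ 1ℚ → ⊥
        top-coefficient zero    F₀≡1
          with () ← trans (sym (proj₂ p²∤constant)) (trans (cong v F₀≡1) v-1)
        top-coefficient (suc n) Fₙ≡1 = ℚ.1≢0 (trans (sym Fₙ≡1) (F-constant n))

      factor-constant : ∀ g h → F ≈ₚ (g *ₚ h) → IsConstant g ⊎ IsConstant h
      factor-constant g h F≈gh with constant-or-degree g | constant-or-degree h
      ... | inj₁ g-constant | _              = inj₁ g-constant
      ... | inj₂ _          | inj₁ h-constant = inj₂ h-constant
      ... | inj₂ (D , deg-g) | inj₂ (E , deg-h)
        with degree-*ₚ-≤ {F} F≈gh deg-g deg-h F-above
           | Factorisation.N≤D⊎N≤E F≈gh (minValuation deg-g) (minValuation deg-h) deg-g deg-h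
      ...   | D+E≤N | inj₁ N≤D = contradiction (ℕ.≤-trans D+E≤N N≤D) (ℕ.<⇒≱ (ℕ.m<m+n (suc D) ℕ.z<s))
      ...   | D+E≤N | inj₂ N≤E = contradiction (ℕ.≤-trans D+E≤N N≤E) (ℕ.<⇒≱ (ℕ.m<n+m (suc E) ℕ.z<s))

coprimeTo-1 : ∀ m → Coprimality.Coprime m 1
coprimeTo-1 m = Coprimality.sym (1-coprimeTo m)

ℕtoℚ≡mkℚ : ∀ m → ℕtoℚ m ≡ mkℚ (+ m) 0 (coprimeTo-1 m)
ℕtoℚ≡mkℚ m = ℚ.normalize-coprime (coprimeTo-1 m)

ℕtoℚ-+ : ∀ m n → ℕtoℚ (m + n) ≡ ℕtoℚ m ℚ.+ ℕtoℚ n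
ℕtoℚ-+ m n = begin
  + (m + n) ℚ./ 1
    ≡⟨ cong (ℚ._/ 1) (ℤ.pos-+ m n) ⟩
  (+ m ℤ.+ + n) ℚ./ 1
    ≡⟨ cong₂ (λ a b → (a ℤ.+ b) ℚ./ 1) (ℤ.*-identityʳ (+ m)) (ℤ.*-identityʳ (+ n)) ⟨
  (+ m ℤ.* + 1 ℤ.+ + n ℤ.* + 1) ℚ./ 1
    ≡⟨⟩
  mkℚ (+ m) 0 (coprimeTo-1 m) ℚ.+ mkℚ (+ n) 0 (coprimeTo-1 n)
    ≡⟨ cong₂ ℚ._+_ (ℕtoℚ≡mkℚ m) (ℕtoℚ≡mkℚ n) ⟨
  ℕtoℚ m ℚ.+ ℕtoℚ n ∎
  where open ≡-Reasoning

monomialCoeff : ℕ → ℕ → ℕ → ℕ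
monomialCoeff w zero    zero    = w
monomialCoeff w zero    (suc i) = 0
monomialCoeff w (suc k) zero    = 0
monomialCoeff w (suc k) (suc i) = monomialCoeff w k i

coeff-monomial : ∀ w k i → coeff (monomial (ℕtoℚ w) k) i ≡ ℕtoℚ (monomialCoeff w k i)
coeff-monomial w zero    zero    = refl
coeff-monomial w zero    (suc i) = refl
coeff-monomial w (suc k) zero    = refl
coeff-monomial w (suc k) (suc i) = coeff-monomial w k i

monomialCoeff-≡ : ∀ w k → monomialCoeff w k k ≡ w
monomialCoeff-≡ w zero    = refl
monomialCoeff-≡ w (suc k) = monomialCoeff-≡ w k

monomialCoeff-≢ : ∀ w {k i} → k ≢ i → monomialCoeff w k i ≡ 0
monomialCoeff-≢ w {zero}  {zero}  k≢i = contradiction refl k≢i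
monomialCoeff-≢ w {zero}  {suc i} k≢i = refl
monomialCoeff-≢ w {suc k} {zero}  k≢i = refl
monomialCoeff-≢ w {suc k} {suc i} k≢i = monomialCoeff-≢ w (k≢i ∘ cong suc)

monomialCoeff-+ : ∀ a b i → monomialCoeff (a + b) 0 i ≡ monomialCoeff a 0 i + monomialCoeff b 0 i
monomialCoeff-+ a b zero    = refl
monomialCoeff-+ a b (suc i) = refl

∣-monomialCoeff : ∀ {d w} k i → d ∣ w → d ∣ monomialCoeff w k i
∣-monomialCoeff zero    zero    d∣w = d∣w
∣-monomialCoeff zero    (suc i) d∣w = _ ℕ.∣0
∣-monomialCoeff (suc k) zero    d∣w = _ ℕ.∣0
∣-monomialCoeff (suc k) (suc i) d∣w = ∣-monomialCoeff k i d∣w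

∑< : ℕ → (ℕ → ℕ) → ℕ
∑< zero    g = 0
∑< (suc k) g = ∑< k g + g k

syntax ∑< k (λ j → e) = ∑[ j < k ] e

foldr-upTo : ∀ (g : ℕ → ℕ) k → foldr (λ j s → g j + s) 0 (upTo k) ≡ ∑[ j < k ] g j
foldr-upTo g zero    = refl
foldr-upTo g (suc k) = begin
  foldr step 0 (upTo (suc k))       ≡⟨ cong (foldr step 0) (List.upTo-∷ʳ k) ⟨
  foldr step 0 (upTo k ∷ʳ k)        ≡⟨ List.foldr-∷ʳ step 0 k (upTo k) ⟩
  foldr step (g k + 0) (upTo k)
    ≡⟨ List.foldr-fusion (_+ (g k + 0)) 0 (λ j s → ℕ.+-assoc (g j) s _) (upTo k) ⟨
  foldr step 0 (upTo k) + (g k + 0) ≡⟨ cong₂ _+_ (foldr-upTo g k) (ℕ.+-identityʳ (g k)) ⟩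
  ∑[ j < k ] g j + g k              ∎
  where
  open ≡-Reasoning
  step = λ j s → g j + s

coeff-monomials : ∀ (w e : ℕ → ℕ) L i →
  coeff (foldr (λ j acc → monomial (ℕtoℚ (w j)) (e j) +ₚ acc) [] L) i ≡
  ℕtoℚ (foldr (λ j s → monomialCoeff (w j) (e j) i + s) 0 L)
coeff-monomials w e []       i = refl
coeff-monomials w e (j ∷ js) i = begin
  coeff (monomial (ℕtoℚ (w j)) (e j) +ₚ rest) i
    ≡⟨ coeff-+ₚ (monomial (ℕtoℚ (w j)) (e j)) rest i ⟩
  coeff (monomial (ℕtoℚ (w j)) (e j)) i ℚ.+ coeff rest i
    ≡⟨ cong₂ ℚ._+_ (coeff-monomial (w j) (e j) i) (coeff-monomials w e js i) ⟩
  ℕtoℚ (term j) ℚ.+ ℕtoℚ (sum js)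
    ≡⟨ ℕtoℚ-+ (term j) (sum js) ⟨
  ℕtoℚ (term j + sum js) ∎
  where
  open ≡-Reasoning
  rest = foldr (λ j acc → monomial (ℕtoℚ (w j)) (e j) +ₚ acc) [] js
  term = λ j → monomialCoeff (w j) (e j) i
  sum  = foldr (λ j s → term j + s) 0

coeff-f : ∀ m n i → coeff (f m n) i ≡ ℕtoℚ (∑[ j < suc n ] monomialCoeff (n C j) (j C m) i)
coeff-f m n i = trans (coeff-monomials (n C_) (_C m) (upTo (suc n)) i)
  (cong ℕtoℚ (foldr-upTo (λ j → monomialCoeff (n C j) (j C m) i) (suc n)))

∑-pascal : ∀ n k → ∑[ j < suc k ] (suc n C j) ≡ ∑[ j < suc k ] (n C j) + ∑[ j < k ] (n C j)
∑-pascal n zero    = refl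
∑-pascal n (suc k) = begin
  ∑[ j < suc k ] (suc n C j) + suc n C suc k
    ≡⟨ cong₂ _+_ (∑-pascal n k) (sym (nCk+nC[k+1]≡[n+1]C[k+1] n k)) ⟩
  (∑[ j < suc k ] (n C j) + ∑[ j < k ] (n C j)) + (n C k + n C suc k)
    ≡⟨ regroup (∑[ j < suc k ] (n C j)) (∑[ j < k ] (n C j)) (n C k) (n C suc k) ⟩
  (∑[ j < suc k ] (n C j) + n C suc k) + (∑[ j < k ] (n C j) + n C k) ∎
  where
  open ≡-Reasoning
  regroup : ∀ a b c d → (a + b) + (c + d) ≡ (a + d) + (b + c)
  regroup = solve-∀

∑-binomial : ∀ n → ∑[ j < suc n ] (n C j) ≡ 2 ^ n
∑-binomial zero    = refl
∑-binomial (suc n) = begin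
  ∑[ j < suc (suc n) ] (suc n C j)  ≡⟨ ∑-pascal n (suc n) ⟩
  (row + n C suc n) + row           ≡⟨ cong (λ c → (row + c) + row) (k>n⇒nCk≡0 (ℕ.n<1+n n)) ⟩
  (row + 0) + row                   ≡⟨ cong (λ s → (s + 0) + s) (∑-binomial n) ⟩
  (2 ^ n + 0) + 2 ^ n               ≡⟨ double (2 ^ n) ⟩
  2 ^ suc n                         ∎
  where
  open ≡-Reasoning
  row = ∑[ j < suc n ] (n C j)
  double : ∀ x → (x + 0) + x ≡ 2 * x
  double = solve-∀

∑-below : ∀ m n i k → k ≤ m →
          ∑[ j < k ] monomialCoeff (n C j) (j C m) i ≡ monomialCoeff (∑[ j < k ] (n C j)) 0 i
∑-below m n zero    zero    _   = refl
∑-below m n (suc i) zero    _   = refl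
∑-below m n i       (suc k) k<m = begin
  ∑[ j < k ] monomialCoeff (n C j) (j C m) i + monomialCoeff (n C k) (k C m) i
    ≡⟨ cong₂ _+_ (∑-below m n i k (ℕ.<⇒≤ k<m))
                 (cong (λ e → monomialCoeff (n C k) e i) (k>n⇒nCk≡0 k<m)) ⟩
  monomialCoeff (∑[ j < k ] (n C j)) 0 i + monomialCoeff (n C k) 0 i
    ≡⟨ monomialCoeff-+ (∑[ j < k ] (n C j)) (n C k) i ⟨
  monomialCoeff (∑[ j < suc k ] (n C j)) 0 i ∎
  where open ≡-Reasoning

[1+n]Cn≡1+n : ∀ n → suc n C n ≡ suc n
[1+n]Cn≡1+n n = begin
  suc n C n           ≡⟨ nCk≡nC[n∸k] (ℕ.n≤1+n n) ⟩
  suc n C (suc n ∸ n) ≡⟨ cong (suc n C_) (ℕ.m+n∸n≡m 1 n) ⟩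
  suc n C 1           ≡⟨ nC1≡n (suc n) ⟩
  suc n               ∎
  where open ≡-Reasoning

2*[1+n]C2≡[1+n]*n : ∀ n → 2 * (suc n C 2) ≡ suc n * n
2*[1+n]C2≡[1+n]*n zero    = refl
2*[1+n]C2≡[1+n]*n (suc n) = begin
  2 * (suc (suc n) C 2)       ≡⟨ cong (2 *_) (nCk+nC[k+1]≡[n+1]C[k+1] (suc n) 1) ⟨
  2 * (suc n C 1 + suc n C 2) ≡⟨ cong (λ c → 2 * (c + suc n C 2)) (nC1≡n (suc n)) ⟩
  2 * (suc n + suc n C 2)     ≡⟨ ℕ.*-distribˡ-+ 2 (suc n) (suc n C 2) ⟩
  2 * suc n + 2 * (suc n C 2) ≡⟨ cong (λ x → 2 * suc n + x) (2*[1+n]C2≡[1+n]*n n) ⟩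
  2 * suc n + suc n * n       ≡⟨ expand n ⟩
  suc (suc n) * suc n         ∎
  where
  open ≡-Reasoning
  expand : ∀ n → 2 * suc n + suc n * n ≡ suc (suc n) * suc n
  expand = solve-∀

2*[2+m]Cm≡[2+m]*[1+m] : ∀ m → 2 * (suc (suc m) C m) ≡ suc (suc m) * suc m
2*[2+m]Cm≡[2+m]*[1+m] m = begin
  2 * (n C m)       ≡⟨ cong (2 *_) (nCk≡nC[n∸k] (ℕ.≤-trans (ℕ.n≤1+n m) (ℕ.n≤1+n (suc m)))) ⟩
  2 * (n C (n ∸ m)) ≡⟨ cong (λ k → 2 * (n C k)) (ℕ.m+n∸n≡m 2 m) ⟩
  2 * (n C 2)       ≡⟨ 2*[1+n]C2≡[1+n]*n (suc m) ⟩
  n * suc m         ∎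
  where
  open ≡-Reasoning
  n = suc (suc m)

1+m<[2+m]Cm : ∀ m → .{{NonZero m}} → suc m < suc (suc m) C m
1+m<[2+m]Cm m = ℕ.*-cancelˡ-< 2 (suc m) (suc (suc m) C m)
  (subst (2 * suc m <_) (sym (2*[2+m]Cm≡[2+m]*[1+m] m))
         (ℕ.*-monoˡ-< (suc m) {2} {suc (suc m)} (s≤s (s≤s (ℕ.>-nonZero⁻¹ m)))))

coeff-f[m,1+m] : ∀ m i → coeff (f m (suc m)) i ≡
  ℕtoℚ (monomialCoeff (∑[ j < m ] (suc m C j)) 0 i + monomialCoeff (suc m) 1 i
        + monomialCoeff 1 (suc m) i)
coeff-f[m,1+m] m i = trans (coeff-f m (suc m) i) (cong ℕtoℚ (cong₂ _+_ (cong₂ _+_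
  (∑-below m (suc m) i m ℕ.≤-refl)
  (cong₂ (λ w e → monomialCoeff w e i) ([1+n]Cn≡1+n m) (nCn≡1 m)))
  (cong₂ (λ w e → monomialCoeff w e i) (nCn≡1 (suc m)) ([1+n]Cn≡1+n m))))

coeff-f[m,2+m] : ∀ m i → coeff (f m (suc (suc m))) i ≡
  ℕtoℚ (monomialCoeff (∑[ j < m ] (suc (suc m) C j)) 0 i + monomialCoeff (suc (suc m) C m) 1 i
        + monomialCoeff (suc (suc m)) (suc m) i + monomialCoeff 1 (suc (suc m) C m) i)
coeff-f[m,2+m] m i = trans (coeff-f m (suc (suc m)) i) (cong ℕtoℚ (cong₂ _+_ (cong₂ _+_ (cong₂ _+_
  (∑-below m (suc (suc m)) i m ℕ.≤-refl)
  (cong (λ e → monomialCoeff (suc (suc m) C m) e i) (nCn≡1 m)))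
  (cong₂ (λ w e → monomialCoeff w e i) ([1+n]Cn≡1+n (suc m)) ([1+n]Cn≡1+n m)))
  (cong (λ w → monomialCoeff w (suc (suc m) C m) i) (nCn≡1 (suc (suc m))))))

row-sum[m,1+m] : ∀ m → ∑[ j < m ] (suc m C j) + suc m + 1 ≡ 2 ^ suc m
row-sum[m,1+m] m = trans
  (sym (cong₂ (λ a b → ∑[ j < m ] (suc m C j) + a + b) ([1+n]Cn≡1+n m) (nCn≡1 (suc m))))
  (∑-binomial (suc m))

row-sum[m,2+m] : ∀ m →
  ∑[ j < m ] (suc (suc m) C j) + (suc (suc m) C m + suc (suc m)) + 1 ≡ 2 ^ suc (suc m)
row-sum[m,2+m] m = begin
  L + (T + n) + 1           ≡⟨ cong (_+ 1) (ℕ.+-assoc L T n) ⟨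
  L + T + n + 1             ≡⟨ cong₂ (λ a b → L + T + a + b) ([1+n]Cn≡1+n (suc m)) (nCn≡1 n) ⟨
  L + T + n C suc m + n C n ≡⟨ ∑-binomial n ⟩
  2 ^ n                     ∎
  where
  open ≡-Reasoning
  n = suc (suc m)
  L = ∑[ j < m ] (n C j)
  T = n C m

infix 4 _≡1mod_

_≡1mod_ : ℕ → ℕ → Set
x ≡1mod M = ∃ λ w → x ≡ 1 + w * M

geometric-sum : ∀ y k → (1 + y) ^ k ≡ 1 + y * ∑[ i < k ] ((1 + y) ^ i)
geometric-sum y zero    = cong suc (sym (ℕ.*-zeroʳ y))
geometric-sum y (suc k) = begin
  (1 + y) * (1 + y) ^ k     ≡⟨ cong ((1 + y) *_) (geometric-sum y k) ⟩
  (1 + y) * (1 + y * S)     ≡⟨ expand y S ⟩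
  1 + y * (S + (1 + y * S)) ≡⟨ cong (λ t → 1 + y * (S + t)) (geometric-sum y k) ⟨
  1 + y * (S + (1 + y) ^ k) ∎
  where
  open ≡-Reasoning
  S = ∑[ i < k ] ((1 + y) ^ i)
  expand : ∀ y s → (1 + y) * (1 + y * s) ≡ 1 + y * (s + (1 + y * s))
  expand = solve-∀

≡1-^ : ∀ {M x} → x ≡1mod M → ∀ k → x ^ k ≡1mod M
≡1-^ {M} (w , refl) k = w * ∑[ i < k ] ((1 + w * M) ^ i) ,
  trans (geometric-sum (w * M) k) (cong suc (swap w M _))
  where
  swap : ∀ w M s → w * M * s ≡ w * s * M
  swap = solve-∀

∑-≡1 : ∀ {M} (g : ℕ → ℕ) → (∀ i → g i ≡1mod M) → ∀ k → ∃ λ s → ∑[ i < k ] g i ≡ k + s * M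
∑-≡1     g g≡1 zero    = 0 , refl
∑-≡1 {M} g g≡1 (suc k) with ∑-≡1 g g≡1 k | g≡1 k
... | s , ∑≡k+sM | w , gk≡1+wM = s + w , trans (cong₂ _+_ ∑≡k+sM gk≡1+wM) (regroup k s w M)
  where
  regroup : ∀ k s w M → (k + s * M) + (1 + w * M) ≡ suc k + (s + w) * M
  regroup = solve-∀

-- (1 + w p)^p = 1 + w p Σ_{i<p} (1 + w p)^i, a sum of p terms each ≡ 1, hence ≡ 0 (mod p).
≡1-lift : ∀ p {x} → x ≡1mod p → x ^ p ≡1mod p * p
≡1-lift p {x} (w , refl) with ∑-≡1 (λ i → (1 + w * p) ^ i) (≡1-^ (w , refl)) p
... | s , ∑≡p+sp = w * (1 + s) , (begin
  (1 + w * p) ^ p                          ≡⟨ geometric-sum (w * p) p ⟩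
  1 + w * p * ∑[ i < p ] ((1 + w * p) ^ i) ≡⟨ cong (λ t → 1 + w * p * t) ∑≡p+sp ⟩
  1 + w * p * (p + s * p)                  ≡⟨ cong suc (regroup w p s) ⟩
  1 + w * (1 + s) * (p * p)                ∎)
  where
  open ≡-Reasoning
  regroup : ∀ w p s → w * p * (p + s * p) ≡ w * (1 + s) * (p * p)
  regroup = solve-∀

module Congruence (M : ℕ) where

  infix 4 _≈_

  record _≈_ (x y : ℤ) : Set where
    constructor mod
    field M∣x-y : + M ℤ.∣ x ℤ.- y

  ≈-reflexive : ∀ {x y} → x ≡ y → x ≈ y
  ≈-reflexive {x} refl = mod (subst (+ M ℤ.∣_) (sym (ℤ.+-inverseʳ x)) (ℤ.divides 0ℤ refl))

  ≈-trans : ∀ {x y z} → x ≈ y → y ≈ z → x ≈ z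
  ≈-trans {x} {y} {z} (mod M∣x-y) (mod M∣y-z) =
    mod (subst (+ M ℤ.∣_) (telescope x y z) (ℤ.∣m∣n⇒∣m+n M∣x-y M∣y-z))
    where
    telescope : ∀ x y z → (x ℤ.- y) ℤ.+ (y ℤ.- z) ≡ x ℤ.- z
    telescope = ℤ-Solver.solve-∀

  ≈-* : ∀ {x y u w} → x ≈ y → u ≈ w → x ℤ.* u ≈ y ℤ.* w
  ≈-* {x} {y} {u} {w} (mod M∣x-y) (mod M∣u-w) = mod (subst (+ M ℤ.∣_) (expand x y u w)
    (ℤ.∣m∣n⇒∣m+n (ℤ.∣n⇒∣m*n x M∣u-w) (ℤ.∣m⇒∣m*n w M∣x-y)))
    where
    expand : ∀ x y u w → x ℤ.* (u ℤ.- w) ℤ.+ (x ℤ.- y) ℤ.* w ≡ x ℤ.* u ℤ.- y ℤ.* w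
    expand = ℤ-Solver.solve-∀

  ≈1⇒≡1mod : ∀ x → .{{NonZero x}} → + x ≈ 1ℤ → x ≡1mod M
  ≈1⇒≡1mod (suc x) (mod M∣x) with ℤ.∣⇒∣ᵤ M∣x
  ... | divides w x≡wM = w , cong suc x≡wM

evenProduct : ℕ → ℕ
evenProduct zero    = 1
evenProduct (suc r) = evenProduct r * (2 * suc r)

oddProduct : ℕ → ℕ
oddProduct zero    = 1
oddProduct (suc r) = oddProduct r * (2 * r + 1)

evenProductFrom : ℕ → ℕ → ℕ
evenProductFrom a zero    = 1
evenProductFrom a (suc c) = 2 * suc a * evenProductFrom (suc a) c

evenProduct-split : ∀ a c → evenProduct (a + c) ≡ evenProduct a * evenProductFrom a c
evenProduct-split a zero    =
  trans (cong evenProduct (ℕ.+-identityʳ a)) (sym (ℕ.*-identityʳ (evenProduct a)))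
evenProduct-split a (suc c) = begin
  evenProduct (a + suc c)                                 ≡⟨ cong evenProduct (ℕ.+-suc a c) ⟩
  evenProduct (suc a + c)                                 ≡⟨ evenProduct-split (suc a) c ⟩
  evenProduct a * (2 * suc a) * evenProductFrom (suc a) c ≡⟨ ℕ.*-assoc (evenProduct a) _ _ ⟩
  evenProduct a * evenProductFrom a (suc c)               ∎
  where open ≡-Reasoning

evenProduct≡2^r*r! : ∀ r → evenProduct r ≡ 2 ^ r * r !
evenProduct≡2^r*r! zero    = refl
evenProduct≡2^r*r! (suc r) =
  trans (cong (_* (2 * suc r)) (evenProduct≡2^r*r! r)) (regroup (2 ^ r) (r !) r)
  where
  regroup : ∀ x y r → x * y * (2 * suc r) ≡ 2 * x * (y + r * y)
  regroup = solve-∀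

factorial-split : ∀ r → (2 * r) ! ≡ evenProduct r * oddProduct r
                      × (suc (2 * r)) ! ≡ evenProduct r * oddProduct (suc r)
factorial-split zero    = refl , refl
factorial-split (suc r) with factorial-split r
... | _ , [2r+1]!≡ = [2r+2]!≡ ,
  trans (cong (suc (2 * suc r) *_) [2r+2]!≡) (regroup₂ (evenProduct r) (oddProduct r) r)
  where
  two-suc : ∀ r → 2 * suc r ≡ suc (suc (2 * r))
  two-suc = solve-∀
  regroup₁ : ∀ e o r → suc (suc (2 * r)) * (e * (o * (2 * r + 1)))
                     ≡ e * (2 * suc r) * (o * (2 * r + 1))
  regroup₁ = solve-∀
  regroup₂ : ∀ e o r → suc (2 * suc r) * (e * (2 * suc r) * (o * (2 * r + 1)))
                     ≡ e * (2 * suc r) * (o * (2 * r + 1) * (2 * suc r + 1))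
  regroup₂ = solve-∀
  [2r+2]!≡ : (2 * suc r) ! ≡ evenProduct (suc r) * oddProduct (suc r)
  [2r+2]!≡ = trans (cong _! (two-suc r)) (trans (cong (suc (suc (2 * r)) *_) [2r+1]!≡)
                                                (regroup₁ (evenProduct r) (oddProduct r) r))

[-1]^[c+c]≡1 : ∀ c → -1ℤ ℤ.^ (c + c) ≡ 1ℤ
[-1]^[c+c]≡1 c = begin
  -1ℤ ℤ.^ (c + c) ≡⟨ cong (-1ℤ ℤ.^_) (c+c≡2*c c) ⟩
  -1ℤ ℤ.^ (2 * c) ≡⟨ ℤ.^-*-assoc -1ℤ 2 c ⟨
  1ℤ ℤ.^ c        ≡⟨ ℤ.^-zeroˡ c ⟩
  1ℤ              ∎
  where
  open ≡-Reasoning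
  c+c≡2*c : ∀ c → c + c ≡ 2 * c
  c+c≡2*c = solve-∀

half-split : ∀ h → ∃ λ a → h ≡ a + a ⊎ h ≡ a + suc a
half-split zero    = 0 , inj₁ refl
half-split (suc h) with half-split h
... | a , inj₁ h≡a+a   = a , inj₂ (trans (cong suc h≡a+a) (sym (ℕ.+-suc a a)))
... | a , inj₂ h≡a+1+a = suc a , inj₁ (cong suc h≡a+1+a)

2h+1-injective : ∀ {h k} → 2 * h + 1 ≡ 2 * k + 1 → h ≡ k
2h+1-injective {h} {k} eq = ℕ.*-cancelˡ-≡ h k 2 (ℕ.+-cancelʳ-≡ 1 (2 * h) (2 * k) eq)

module PowersOfTwo {p : ℕ} (p-prime : Prime p) where

  open ℕValuation p-prime using (p∤1)
  open Congruence p

  ≈-cancelʳ : ∀ {x y n} → ¬ p ∣ n → x ℤ.* + n ≈ y ℤ.* + n → x ≈ y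
  ≈-cancelʳ {x} {y} {n} p∤n (mod p∣xn-yn) with euclidsLemma ∣ x ℤ.- y ∣ n p-prime p∣∣x-y∣*n
    where
    p∣∣x-y∣*n : p ∣ ∣ x ℤ.- y ∣ * n
    p∣∣x-y∣*n = subst (p ∣_) (trans (cong ∣_∣ (factor x y (+ n))) (ℤ.abs-* (x ℤ.- y) (+ n)))
                             (ℤ.∣⇒∣ᵤ p∣xn-yn)
      where
      factor : ∀ x y n → x ℤ.* n ℤ.- y ℤ.* n ≡ (x ℤ.- y) ℤ.* n
      factor = ℤ-Solver.solve-∀
  ... | inj₁ p∣∣x-y∣ = mod (ℤ.∣ᵤ⇒∣ p∣∣x-y∣)
  ... | inj₂ p∣n     = contradiction p∣n p∤n

  p∤r! : ∀ r → r < p → ¬ p ∣ r !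
  p∤r! zero    _   = p∤1
  p∤r! (suc r) r<p p∣r! with euclidsLemma (suc r) (r !) p-prime p∣r!
  ... | inj₁ p∣1+r = ℕ.<⇒≱ r<p (ℕ.∣⇒≤ p∣1+r)
  ... | inj₂ p∣r!  = p∤r! r (ℕ.<-trans (ℕ.n<1+n r) r<p) p∣r!

  -- 2(a + 1) + (2c + 1) = p: the even factors 2(a+1), …, 2(a+c) are, from the left, ≡ minus the
  -- odd numbers 2c − 1, …, 1.
  evenProductFrom≈±oddProduct : ∀ a c → p ≡ 2 * (a + c) + 1 →
                                + evenProductFrom a c ≈ -1ℤ ℤ.^ c ℤ.* + oddProduct c
  evenProductFrom≈±oddProduct a zero    _  = ≈-reflexive refl
  evenProductFrom≈±oddProduct a (suc c) p≡ =
    ≈-trans (≈-reflexive (ℤ.pos-* (2 * suc a) _))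
      (≈-trans (≈-* 2[a+1]≈-[2c+1] (evenProductFrom≈±oddProduct (suc a) c p≡′))
        (≈-reflexive (trans (regroup (+ (2 * c + 1)) (-1ℤ ℤ.^ c) (+ oddProduct c))
                            (cong (-1ℤ ℤ.^ suc c ℤ.*_) (sym (ℤ.pos-* (oddProduct c) (2 * c + 1)))))))
    where
    p≡′ : p ≡ 2 * (suc a + c) + 1
    p≡′ = trans p≡ (cong (λ k → 2 * k + 1) (ℕ.+-suc a c))
    regroup : ∀ b s o → (ℤ.- b) ℤ.* (s ℤ.* o) ≡ (-1ℤ ℤ.* s) ℤ.* (o ℤ.* b)
    regroup = ℤ-Solver.solve-∀
    2[a+1]≈-[2c+1] : + (2 * suc a) ≈ ℤ.- + (2 * c + 1)
    2[a+1]≈-[2c+1] = mod (subst (+ p ℤ.∣_) p≡difference ℤ.∣-refl)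
      where
      p≡difference : + p ≡ + (2 * suc a) ℤ.- ℤ.- + (2 * c + 1)
      p≡difference = begin
        + p                                 ≡⟨ cong +_ (trans p≡ (rearrange a c)) ⟩
        + (2 * suc a + (2 * c + 1))         ≡⟨ ℤ.pos-+ (2 * suc a) (2 * c + 1) ⟩
        + (2 * suc a) ℤ.+ + (2 * c + 1)
          ≡⟨ cong (λ z → + (2 * suc a) ℤ.+ z) (ℤ.neg-involutive (+ (2 * c + 1))) ⟨
        + (2 * suc a) ℤ.- ℤ.- + (2 * c + 1) ∎
        where
        open ≡-Reasoning
        rearrange : ∀ a c → 2 * (a + suc c) + 1 ≡ 2 * suc a + (2 * c + 1)
        rearrange = solve-∀

  -- Gauss's lemma for 2: 2^h h! is the product of the even numbers up to 2h; the factors beyond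
  -- 2a contribute (-1)^c times the odd numbers below 2c, and what remains is h! again.
  2^[a+c]≈[-1]^c : ∀ a c → p ≡ 2 * (a + c) + 1 → (a + c) ! ≡ evenProduct a * oddProduct c →
                   + (2 ^ (a + c)) ≈ -1ℤ ℤ.^ c
  2^[a+c]≈[-1]^c a c p≡ h!≡ = ≈-cancelʳ (p∤r! h h<p)
    (≈-trans (≈-reflexive 2^h*h!≡)
      (≈-trans (≈-* (≈-reflexive {+ evenProduct a} refl) (evenProductFrom≈±oddProduct a c p≡))
               (≈-reflexive ±h!≡)))
    where
    h = a + c
    s = -1ℤ ℤ.^ c
    h<p : h < p
    h<p = subst (h <_) (sym p≡) (ℕ.≤-<-trans (ℕ.m≤n*m h 2) (ℕ.m<m+n (2 * h) ℕ.z<s))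
    2^h*h!≡ : + (2 ^ h) ℤ.* + (h !) ≡ + evenProduct a ℤ.* + evenProductFrom a c
    2^h*h!≡ = begin
      + (2 ^ h) ℤ.* + (h !)                     ≡⟨ ℤ.pos-* (2 ^ h) (h !) ⟨
      + (2 ^ h * h !)                           ≡⟨ cong +_ (evenProduct≡2^r*r! h) ⟨
      + evenProduct h                           ≡⟨ cong +_ (evenProduct-split a c) ⟩
      + (evenProduct a * evenProductFrom a c)   ≡⟨ ℤ.pos-* (evenProduct a) (evenProductFrom a c) ⟩
      + evenProduct a ℤ.* + evenProductFrom a c ∎
      where open ≡-Reasoning
    ±h!≡ : + evenProduct a ℤ.* (s ℤ.* + oddProduct c) ≡ s ℤ.* + (h !)
    ±h!≡ = begin
      + evenProduct a ℤ.* (s ℤ.* + oddProduct c) ≡⟨ ℤ.*-comm (+ evenProduct a) _ ⟩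
      s ℤ.* + oddProduct c ℤ.* + evenProduct a   ≡⟨ ℤ.*-assoc s _ _ ⟩
      s ℤ.* (+ oddProduct c ℤ.* + evenProduct a) ≡⟨ cong (s ℤ.*_) (ℤ.pos-* (oddProduct c) _) ⟨
      s ℤ.* + (oddProduct c * evenProduct a)
        ≡⟨ cong (λ k → s ℤ.* + k) (trans (ℕ.*-comm (oddProduct c) (evenProduct a)) (sym h!≡)) ⟩
      s ℤ.* + (h !)                              ∎
      where open ≡-Reasoning

  2^[a+a]≈[-1]^a : ∀ a → p ≡ 2 * (a + a) + 1 → + (2 ^ (a + a)) ≈ -1ℤ ℤ.^ a
  2^[a+a]≈[-1]^a a p≡ =
    2^[a+c]≈[-1]^c a a p≡ (trans (cong _! (a+a≡2*a a)) (proj₁ (factorial-split a)))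
    where
    a+a≡2*a : ∀ a → a + a ≡ 2 * a
    a+a≡2*a = solve-∀

  2^[a+1+a]≈[-1]^[1+a] : ∀ a → p ≡ 2 * (a + suc a) + 1 → + (2 ^ (a + suc a)) ≈ -1ℤ ℤ.^ suc a
  2^[a+1+a]≈[-1]^[1+a] a p≡ =
    2^[a+c]≈[-1]^c a (suc a) p≡ (trans (cong _! (a+1+a≡1+2*a a)) (proj₂ (factorial-split a)))
    where
    a+1+a≡1+2*a : ∀ a → a + suc a ≡ suc (2 * a)
    a+1+a≡1+2*a = solve-∀

  2^h≈±1 : ∀ h → p ≡ 2 * h + 1 → ∃ λ c → + (2 ^ h) ≈ -1ℤ ℤ.^ c
  2^h≈±1 h p≡ with half-split h
  ... | a , inj₁ refl = a , 2^[a+a]≈[-1]^a a p≡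
  ... | a , inj₂ refl = suc a , 2^[a+1+a]≈[-1]^[1+a] a p≡

  ≈[-1]^[c+c]⇒≡1mod : ∀ x c → .{{NonZero x}} → + x ≈ -1ℤ ℤ.^ (c + c) → x ≡1mod p
  ≈[-1]^[c+c]⇒≡1mod x c x≈ = ≈1⇒≡1mod x (≈-trans x≈ (≈-reflexive ([-1]^[c+c]≡1 c)))

  2^[p-1]≡1 : ∀ h → p ≡ 2 * h + 1 → 2 ^ (h + h) ≡1mod p
  2^[p-1]≡1 h p≡ with 2^h≈±1 h p≡
  ... | c , 2^h≈±1 = ≈[-1]^[c+c]⇒≡1mod (2 ^ (h + h)) c {{ℕ.m^n≢0 2 (h + h)}}
    (≈-trans (≈-reflexive (trans (cong +_ (ℕ.^-distribˡ-+-* 2 h h)) (ℤ.pos-* (2 ^ h) (2 ^ h))))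
      (≈-trans (≈-* 2^h≈±1 2^h≈±1) (≈-reflexive (sym (ℤ.^-distribˡ-+-* -1ℤ c c)))))

  2^[[p-1]/2]≡1 : ∀ h t → p ≡ 2 * h + 1 → p ≡ 1 + t * 8 ⊎ p ≡ 7 + t * 8 → 2 ^ h ≡1mod p
  2^[[p-1]/2]≡1 h t p≡2h+1 (inj₁ p≡1+8t) with h≡4t
    where
    h≡4t : h ≡ (t + t) + (t + t)
    h≡4t = 2h+1-injective (trans (sym p≡2h+1) (trans p≡1+8t (eight t)))
      where
      eight : ∀ t → 1 + t * 8 ≡ 2 * ((t + t) + (t + t)) + 1
      eight = solve-∀
  ... | refl = ≈[-1]^[c+c]⇒≡1mod (2 ^ h) t {{ℕ.m^n≢0 2 h}} (2^[a+a]≈[-1]^a (t + t) p≡2h+1)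
  2^[[p-1]/2]≡1 h t p≡2h+1 (inj₂ p≡7+8t) with h≡4t+3
    where
    h≡4t+3 : h ≡ suc (t + t) + suc (suc (t + t))
    h≡4t+3 = 2h+1-injective (trans (sym p≡2h+1) (trans p≡7+8t (eight t)))
      where
      eight : ∀ t → 7 + t * 8 ≡ 2 * (suc (t + t) + suc (suc (t + t))) + 1
      eight = solve-∀
  ... | refl = ≈[-1]^[c+c]⇒≡1mod (2 ^ h) (suc t) {{ℕ.m^n≢0 2 h}}
    (≈-trans (2^[a+1+a]≈[-1]^[1+a] (suc (t + t)) p≡2h+1)
             (≈-reflexive (cong (λ k → -1ℤ ℤ.^ suc k) (sym (ℕ.+-suc t t)))))

∥-complement : ∀ {d a b x} → a + b + 1 ≡ x → x ≡1mod d * d → d ∣ b → ¬ d * d ∣ b →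
               (d ∣ a) × ¬ (d * d ∣ a)
∥-complement {d} {a} {b} a+b+1≡1+wd² (w , refl) d∣b d²∤b = d∣a , d²∤a
  where
  d²∣a+b : d * d ∣ a + b
  d²∣a+b = divides w (ℕ.+-cancelʳ-≡ 1 (a + b) (w * (d * d)) (trans a+b+1≡1+wd² (ℕ.+-comm 1 _)))
  d∣a : d ∣ a
  d∣a = ℕ.∣m+n∣m⇒∣n (subst (d ∣_) (ℕ.+-comm a b) (ℕ.∣-trans (ℕ.m∣m*n d) d²∣a+b)) d∣b
  d²∤a : ¬ d * d ∣ a
  d²∤a d²∣a = d²∤b (ℕ.∣m+n∣m⇒∣n d²∣a+b d²∣a)

module Irreducibility {p : ℕ} (p-prime : Prime p) where

  open ℕValuation p-prime using (p≢0; p∤1)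
  open ℚValuation p-prime
  open Eisenstein p-prime

  eisenstein-ℕ : ∀ {F} (c : ℕ → ℕ) N → 0 < N → (∀ i → coeff F i ≡ ℕtoℚ (c i)) →
                 c N ≡ 1 → (∀ i → N < i → c i ≡ 0) →
                 (∀ i → i < N → p ∣ c i) → ¬ p * p ∣ c 0 → Irreducible F
  eisenstein-ℕ {F} c N 0<N F≡c cN≡1 c-above p∣c p²∤c₀ = eisenstein {F} {N}
    (trans (F≡c N) (cong ℕtoℚ cN≡1))
    (λ i N<i → trans (F≡c i) (cong ℕtoℚ (c-above i N<i)))
    (λ i i<N → subst (1ℤ ≤ᵥ_) (sym (F≡c i)) (∣⇒1≤ᵥ (p∣c i i<N)))
    (subst (1ℤ ≡ᵥ_) (sym (F≡c 0)) (∣∧∤⇒1≡ᵥ (p∣c 0 0<N) p²∤c₀))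

  p²∣m*n∧p∤n⇒p²∣m : ∀ {m n} → p * p ∣ m * n → ¬ p ∣ n → p * p ∣ m
  p²∣m*n∧p∤n⇒p²∣m {m} {n} p²∣mn p∤n
    with euclidsLemma m n p-prime (ℕ.∣-trans (ℕ.m∣m*n p) p²∣mn)
  ... | inj₂ p∣n = contradiction p∣n p∤n
  ... | inj₁ (divides q refl) with euclidsLemma q n p-prime p∣qn
    where
    p∣qn : p ∣ q * n
    p∣qn = ℕ.*-cancelʳ-∣ p (subst (p * p ∣_) (regroup q p n) p²∣mn)
      where
      regroup : ∀ q p n → q * p * n ≡ q * n * p
      regroup = solve-∀
  ...   | inj₁ p∣q = ℕ.*-monoˡ-∣ p p∣q
  ...   | inj₂ p∣n = contradiction p∣n p∤n

  p∣[2+m]Cm : ∀ m → ¬ p ∣ 2 → p ∣ suc (suc m) → p ∣ suc (suc m) C m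
  p∣[2+m]Cm m p∤2 p∣n
    with euclidsLemma 2 _ p-prime
           (subst (p ∣_) (sym (2*[2+m]Cm≡[2+m]*[1+m] m)) (ℕ.∣m⇒∣m*n (suc m) p∣n))
  ... | inj₁ p∣2 = contradiction p∣2 p∤2
  ... | inj₂ p∣T = p∣T

  p²∤[2+m]Cm+[2+m] : ∀ m → p ∣ suc (suc m) → ¬ p * p ∣ suc (suc m) →
                     ¬ p * p ∣ suc (suc m) C m + suc (suc m)
  p²∤[2+m]Cm+[2+m] m p∣n p²∤n p²∣T+n =
    p²∤n (p²∣m*n∧p∤n⇒p²∣m (subst (p * p ∣_) 2[T+n]≡n*[n+1] (ℕ.∣n⇒∣m*n 2 p²∣T+n)) p∤n+1)
    where
    n = suc (suc m)
    T = n C m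
    2[T+n]≡n*[n+1] : 2 * (T + n) ≡ n * suc n
    2[T+n]≡n*[n+1] = trans (ℕ.*-distribˡ-+ 2 T n)
      (trans (cong (_+ 2 * n) (2*[2+m]Cm≡[2+m]*[1+m] m)) (expand m))
      where
      expand : ∀ m → (2 + m) * (1 + m) + 2 * (2 + m) ≡ (2 + m) * (3 + m)
      expand = solve-∀
    p∤n+1 : ¬ p ∣ suc n
    p∤n+1 p∣n+1 = p∤1 (ℕ.∣m+n∣m⇒∣n (subst (p ∣_) (ℕ.+-comm 1 n) p∣n+1) p∣n)

  irreducible-f[n∸1,n] : ∀ n → p ∣ n → ¬ p * p ∣ n → 2 ^ n ≡1mod p * p →
                         Irreducible (f (n ∸ 1) n)
  irreducible-f[n∸1,n] zero            _   p²∤0 _ = contradiction ((p * p) ℕ.∣0) p²∤0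
  irreducible-f[n∸1,n] (suc zero)      p∣1 _    _ = contradiction p∣1 p∤1
  irreducible-f[n∸1,n] n@(suc (suc m)) p∣n p²∤n 2^n≡1 = eisenstein-ℕ {f (suc m) n} c n ℕ.z<s
    (coeff-f[m,1+m] (suc m)) (monomialCoeff-≡ 1 n) c-above p∣c
    (proj₂ L-exact ∘ subst (p * p ∣_) c₀≡L)
    where
    L = ∑[ j < suc m ] (n C j)
    c : ℕ → ℕ
    c i = monomialCoeff L 0 i + monomialCoeff n 1 i + monomialCoeff 1 n i
    c₀≡L : c 0 ≡ L
    c₀≡L = trans (ℕ.+-identityʳ _) (ℕ.+-identityʳ L)
    L-exact : (p ∣ L) × ¬ (p * p ∣ L)
    L-exact = ∥-complement (row-sum[m,1+m] (suc m)) 2^n≡1 p∣n p²∤n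
    c-above : ∀ i → n < i → c i ≡ 0
    c-above i n<i = cong₂ _+_
      (cong₂ _+_ (monomialCoeff-≢ L (ℕ.<⇒≢ (ℕ.<-trans ℕ.z<s n<i)))
                 (monomialCoeff-≢ n (ℕ.<⇒≢ (ℕ.<-trans (s≤s (s≤s z≤n)) n<i))))
      (monomialCoeff-≢ 1 (ℕ.<⇒≢ n<i))
    p∣c : ∀ i → i < n → p ∣ c i
    p∣c zero    _   = subst (p ∣_) (sym c₀≡L) (proj₁ L-exact)
    p∣c (suc i) i<n = ℕ.∣m∣n⇒∣m+n (∣-monomialCoeff 1 (suc i) p∣n)
                                  (subst (p ∣_) (sym (monomialCoeff-≢ 1 (ℕ.>⇒≢ i<n))) (p ℕ.∣0))

  irreducible-f[n∸2,n] : ∀ n → ¬ p ∣ 2 → p ∣ n → ¬ p * p ∣ n → 2 ^ n ≡1mod p * p →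
                         Irreducible (f (n ∸ 2) n)
  irreducible-f[n∸2,n] zero                  _   _   p²∤0 _ = contradiction ((p * p) ℕ.∣0) p²∤0
  irreducible-f[n∸2,n] (suc zero)            _   p∣1 _    _ = contradiction p∣1 p∤1
  irreducible-f[n∸2,n] (suc (suc zero))      p∤2 p∣2 _    _ = contradiction p∣2 p∤2
  irreducible-f[n∸2,n] n@(suc (suc (suc k))) p∤2 p∣n p²∤n 2^n≡1 = eisenstein-ℕ {f m n} c T 0<T
    (coeff-f[m,2+m] m) cT≡1 c-above p∣c (proj₂ L-exact ∘ subst (p * p ∣_) c₀≡L)
    where
    m = suc k
    T = n C m
    L = ∑[ j < m ] (n C j)
    c : ℕ → ℕ
    c i = monomialCoeff L 0 i + monomialCoeff T 1 i + monomialCoeff n (suc m) i + monomialCoeff 1 T i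
    n-1<T : suc m < T
    n-1<T = 1+m<[2+m]Cm m
    1<T : 1 < T
    1<T = ℕ.<-trans (s≤s (s≤s z≤n)) n-1<T
    0<T : 0 < T
    0<T = ℕ.<-trans ℕ.z<s 1<T
    p∣T : p ∣ T
    p∣T = p∣[2+m]Cm m p∤2 p∣n
    c₀≡L : c 0 ≡ L
    c₀≡L = trans (cong (λ x → L + 0 + 0 + x) (monomialCoeff-≢ 1 (ℕ.>⇒≢ 0<T)))
                 (trans (ℕ.+-identityʳ _) (trans (ℕ.+-identityʳ _) (ℕ.+-identityʳ L)))
    L-exact : (p ∣ L) × ¬ (p * p ∣ L)
    L-exact = ∥-complement (row-sum[m,2+m] m) 2^n≡1
      (ℕ.∣m∣n⇒∣m+n p∣T p∣n) (p²∤[2+m]Cm+[2+m] m p∣n p²∤n)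
    cT≡1 : c T ≡ 1
    cT≡1 = cong₂ _+_ (cong₂ _+_ (cong₂ _+_ (monomialCoeff-≢ L (ℕ.<⇒≢ 0<T))
                                          (monomialCoeff-≢ T (ℕ.<⇒≢ 1<T)))
                                (monomialCoeff-≢ n (ℕ.<⇒≢ n-1<T)))
                     (monomialCoeff-≡ 1 T)
    c-above : ∀ i → T < i → c i ≡ 0
    c-above i T<i = cong₂ _+_ (cong₂ _+_ (cong₂ _+_
      (monomialCoeff-≢ L (ℕ.<⇒≢ (ℕ.<-trans 0<T T<i)))
      (monomialCoeff-≢ T (ℕ.<⇒≢ (ℕ.<-trans 1<T T<i))))
      (monomialCoeff-≢ n (ℕ.<⇒≢ (ℕ.<-trans n-1<T T<i))))
      (monomialCoeff-≢ 1 (ℕ.<⇒≢ T<i))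
    p∣c : ∀ i → i < T → p ∣ c i
    p∣c zero    _   = subst (p ∣_) (sym c₀≡L) (proj₁ L-exact)
    p∣c (suc i) i<T = ℕ.∣m∣n⇒∣m+n
      (ℕ.∣m∣n⇒∣m+n (∣-monomialCoeff 1 (suc i) p∣T) (∣-monomialCoeff (suc m) (suc i) p∣n))
      (subst (p ∣_) (sym (monomialCoeff-≢ 1 (ℕ.>⇒≢ i<T))) (p ℕ.∣0))

module OddPrime {p : ℕ} (p-prime : Prime p) (p%2≡1 : p % 2 ≡ 1) where

  open ℕValuation p-prime using (p≢0)
  open PowersOfTwo p-prime public
  open Irreducibility p-prime public

  h : ℕ
  h = p / 2

  p≡2h+1 : p ≡ 2 * h + 1
  p≡2h+1 = trans (m≡m%n+[m/n]*n p 2) (trans (cong (_+ h * 2) p%2≡1) (swap h))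
    where
    swap : ∀ h → 1 + h * 2 ≡ 2 * h + 1
    swap = solve-∀

  2h≡h+h : 2 * h ≡ h + h
  2h≡h+h = cong (λ x → h + x) (ℕ.+-identityʳ h)

  p∸1≡h+h : p ∸ 1 ≡ h + h
  p∸1≡h+h = trans (cong (_∸ 1) p≡2h+1) (trans (ℕ.m+n∸n≡m (2 * h) 1) 2h≡h+h)

  h+h<p : h + h < p
  h+h<p = subst (h + h <_) (sym (trans p≡2h+1 (cong (_+ 1) 2h≡h+h))) (ℕ.m<m+n (h + h) ℕ.z<s)

  1<p : 1 < p
  1<p = ℕ.nonTrivial⇒n>1 p {{prime⇒nonTrivial p-prime}}

  1≤h : 1 ≤ h
  1≤h = ℕ.≮⇒≥ λ h<1 → ℕ.<⇒≢ 1<p (sym (trans p≡2h+1 (cong (λ k → 2 * k + 1) (ℕ.n<1⇒n≡0 h<1))))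

  p∤2 : ¬ p ∣ 2
  p∤2 p∣2 with () ← trans (sym p%2≡1) (cong (_% 2) (ℕ.≤-antisym (ℕ.∣⇒≤ p∣2) 1<p))

  p≡±1[mod8] : p % 8 ≡ 1 ⊎ p % 8 ≡ 7 → p ≡ 1 + p / 8 * 8 ⊎ p ≡ 7 + p / 8 * 8
  p≡±1[mod8] (inj₁ p%8≡1) = inj₁ (trans (m≡m%n+[m/n]*n p 8) (cong (_+ p / 8 * 8) p%8≡1))
  p≡±1[mod8] (inj₂ p%8≡7) = inj₂ (trans (m≡m%n+[m/n]*n p 8) (cong (_+ p / 8 * 8) p%8≡7))

  j*[p∸1]*p/2≡j*h*p : ∀ j → j * (p ∸ 1) * p / 2 ≡ j * h * p
  j*[p∸1]*p/2≡j*h*p j = trans (cong (λ k → j * k * p / 2) p∸1≡h+h)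
                              (trans (cong (_/ 2) (regroup j h p)) (m*n/n≡m (j * h * p) 2))
    where
    regroup : ∀ j h p → j * (h + h) * p ≡ j * h * p * 2
    regroup = solve-∀

  p∤j*e : ∀ {j e} → ¬ p ∣ j → 1 ≤ e → e < p → ¬ p ∣ j * e
  p∤j*e {j} {e} p∤j 1≤e e<p p∣je with euclidsLemma j e p-prime p∣je
  ... | inj₁ p∣j = p∤j p∣j
  ... | inj₂ p∣e = ℕ.<⇒≱ e<p (ℕ.∣⇒≤ {{ℕ.>-nonZero 1≤e}} p∣e)

  irreducible-f-pair : ∀ j e n → n ≡ j * e * p → 2 ^ e ≡1mod p → ¬ p ∣ j * e →
                       Irreducible (f (n ∸ 1) n) × Irreducible (f (n ∸ 2) n)
  irreducible-f-pair j e n refl 2^e≡1 p∤je =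
    irreducible-f[n∸1,n] n p∣n p²∤n 2^n≡1 , irreducible-f[n∸2,n] n p∤2 p∣n p²∤n 2^n≡1
    where
    p∣n : p ∣ n
    p∣n = ℕ.n∣m*n (j * e)
    p²∤n : ¬ p * p ∣ n
    p²∤n = p∤je ∘ ℕ.*-cancelʳ-∣ p
    2^n≡1 : 2 ^ n ≡1mod p * p
    2^n≡1 = subst (_≡1mod p * p) [2^e]^p^j≡2^n (≡1-^ (≡1-lift p 2^e≡1) j)
      where
      regroup : ∀ e p j → e * (p * j) ≡ j * e * p
      regroup = solve-∀
      [2^e]^p^j≡2^n : ((2 ^ e) ^ p) ^ j ≡ 2 ^ n
      [2^e]^p^j≡2^n = trans (ℕ.^-*-assoc (2 ^ e) p j)
                              (trans (ℕ.^-*-assoc 2 e (p * j)) (cong (2 ^_) (regroup e p j)))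

corollary6p2 : (p j n : ℕ) → Prime p → p % 2 ≡ 1 → j ≥ 1 → ¬ (p ∣ j)
    → (n ≡ j * (p ∸ 1) * p ⊎ ((p % 8 ≡ 1 ⊎ p % 8 ≡ 7) × n ≡ j * (p ∸ 1) * p / 2))
    → Irreducible (f (n ∸ 1) n) × Irreducible (f (n ∸ 2) n)
corollary6p2 p j n p-prime p%2≡1 _ p∤j (inj₁ n≡j[p∸1]p) =
  irreducible-f-pair j (h + h) n (trans n≡j[p∸1]p (cong (λ e → j * e * p) p∸1≡h+h))
    (2^[p-1]≡1 h p≡2h+1) (p∤j*e p∤j (ℕ.≤-trans 1≤h (ℕ.m≤m+n h h)) h+h<p)
  where open OddPrime p-prime p%2≡1
corollary6p2 p j n p-prime p%2≡1 _ p∤j (inj₂ (p%8≡±1 , n≡j[p∸1]p/2)) =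
  irreducible-f-pair j h n (trans n≡j[p∸1]p/2 (j*[p∸1]*p/2≡j*h*p j))
    (2^[[p-1]/2]≡1 h (p / 8) p≡2h+1 (p≡±1[mod8] p%8≡±1))
    (p∤j*e p∤j 1≤h (ℕ.≤-<-trans (ℕ.m≤m+n h h) h+h<p))
  where open OddPrime p-prime p%2≡1
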